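{- Let $n$ be a positive integer. If there exists a Kirkman frame of type $(6;12)^n$, then there exists a Kirkman triple system of order $12n+3$ which contains as a subdesign a Steiner triple system of order $6n+1$.
   Context: An STS$(v)$ is a set of $v$ points with a set of 3-subsets (blocks) such that each pair of distinct points lies in exactly one block; a KTS$(v)$ is an STS$(v)$ whose blocks partition into parallel classes; a subdesign is a subset of points with a subset of blocks forming an STS on that subset. A 3-GDD of type $g^u$ on a point set $V$ is a partition of $V$ into $u$ groups of size $g$ with 3-subset blocks, each meeting every group in at most one point, such that any two points in different groups lie in exactly one block. A Kirkman frame is a 3-GDD whose blocks can be partitioned into partial parallel classes, each a partition of $V\setminus V_i$ for some group $V_i$. A Kirkman frame of type $(g;h)^u$ is a Kirkman frame of type $h^u$ (groups $V_i$, blocks $\mathcal{B}$) together with a 3-GDD of type $g^u$ (groups $W_i$, blocks $\mathcal{A}$) with $W_i\subseteq V_i$ for all $i$ and $\mathcal{A}\subseteq\mathcal{B}$. -}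

module Defs where

open import Data.Nat using (ℕ; suc; _+_; _*_)
open import Data.Fin using (Fin)
open import Data.Fin.Properties using (_≟_)
open import Data.Fin.Subset using (Subset; _∈_; _∉_; ∣_∣; _∩_)
open import Data.Vec using (tabulate)
open import Data.List using (List; length; lookup)
open import Data.Product using (Σ; _×_; _,_)
open import Data.Sum using (_⊎_)
open import Data.Empty using (⊥)
open import Relation.Binary.PropositionalEquality using (_≡_; _≢_)
open import Relation.Nullary.Decidable using (⌊_⌋)

-- Blocks: 3-subsets of the point set Fin N, represented as triples.

Block : ℕ → Set
Block N = Fin N × Fin N × Fin N

IsTriple : ∀ {N} → Block N → Set
IsTriple (a , b , c) = a ≢ b × a ≢ c × b ≢ c

_∈B_ : ∀ {N} → Fin N → Block N → Set
x ∈B (a , b , c) = x ≡ a ⊎ x ≡ b ⊎ x ≡ c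

Idx : ∀ {N} → List (Block N) → Set
Idx B = Fin (length B)

blk : ∀ {N} (B : List (Block N)) → Idx B → Block N
blk B i = lookup B i

ExactlyOne : ∀ {k} → (Fin k → Set) → Set
ExactlyOne {k} P = Σ (Fin k) λ i → P i × (∀ j → P j → j ≡ i)

NoneSat : ∀ {k} → (Fin k → Set) → Set
NoneSat {k} P = ∀ (i : Fin k) → P i → ⊥

IsSTS : (v : ℕ) → List (Block v) → Set
IsSTS v B =
  (∀ i → IsTriple (blk B i)) ×
  (∀ (x y : Fin v) → x ≢ y →
     ExactlyOne (λ i → x ∈B blk B i × y ∈B blk B i))

-- a resolution: a labelling of the blocks by classes such that every
-- class is a parallel class (each point lies in exactly one block of it)
IsResolution : ∀ {v} → (B : List (Block v)) → Set
IsResolution {v} B =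
  Σ ℕ λ m → Σ (Idx B → Fin m) λ cls →
    ∀ (c : Fin m) (x : Fin v) →
      ExactlyOne (λ i → cls i ≡ c × x ∈B blk B i)

IsKTS : (v : ℕ) → List (Block v) → Set
IsKTS v B = IsSTS v B × IsResolution B

HasSubSTS : ∀ {v} → (B : List (Block v)) → ℕ → Set
HasSubSTS {v} B w =
  Σ (Subset v) λ S → Σ (Subset (length B)) λ D →
    ∣ S ∣ ≡ w ×
    (∀ i → i ∈ D → ∀ x → x ∈B blk B i → x ∈ S) ×
    (∀ (x y : Fin v) → x ∈ S → y ∈ S → x ≢ y →
       ExactlyOne (λ i → i ∈ D × x ∈B blk B i × y ∈B blk B i))

groupSet : ∀ {N u} → (Fin N → Fin u) → Fin u → Subset N
groupSet G i = tabulate (λ x → ⌊ G x ≟ i ⌋)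

Transversal : ∀ {N u} → (Fin N → Fin u) → Block N → Set
Transversal G (a , b , c) = G a ≢ G b × G a ≢ G c × G b ≢ G c

Is3GDD : (h u : ℕ) {N : ℕ} → (Fin N → Fin u) → List (Block N) → Set
Is3GDD h u {N} G B =
  (∀ (i : Fin u) → ∣ groupSet G i ∣ ≡ h) ×
  (∀ i → Transversal G (blk B i)) ×
  (∀ (x y : Fin N) → G x ≢ G y →
     ExactlyOne (λ i → x ∈B blk B i × y ∈B blk B i))

-- partition of the blocks into partial parallel classes, each class c
-- being a partition of V \ V_(hole c)
IsFrameResolution : ∀ {N u} → (Fin N → Fin u) → List (Block N) → Set
IsFrameResolution {N} {u} G B =
  Σ ℕ λ m → Σ (Idx B → Fin m) λ cls → Σ (Fin m → Fin u) λ hole →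
    ∀ (c : Fin m) (x : Fin N) →
      (G x ≡ hole c → NoneSat (λ i → cls i ≡ c × x ∈B blk B i)) ×
      (G x ≢ hole c → ExactlyOne (λ i → cls i ≡ c × x ∈B blk B i))

IsKirkmanFrame : (h u : ℕ) {N : ℕ} → (Fin N → Fin u) → List (Block N) → Set
IsKirkmanFrame h u G B = Is3GDD h u G B × IsFrameResolution G B

-- Kirkman frame of type (g;h)^u: a Kirkman frame of type h^u (groups V_i
-- given by G, blocks B) with a 3-GDD of type g^u on W (groups
-- W_i = W ∩ V_i ⊆ V_i, blocks A ⊆ B)
KirkmanFrameGH : (g h u : ℕ) → Set
KirkmanFrameGH g h u =
  Σ (Fin (h * u) → Fin u) λ G → Σ (List (Block (h * u))) λ B →
  IsKirkmanFrame h u G B ×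
  Σ (Subset (h * u)) λ W → Σ (Subset (length B)) λ A →
    (∀ (i : Fin u) → ∣ W ∩ groupSet G i ∣ ≡ g) ×
    (∀ i → i ∈ A → ∀ x → x ∈B blk B i → x ∈ W) ×
    (∀ (x y : Fin (h * u)) → x ∈ W → y ∈ W → G x ≢ G y →
       ExactlyOne (λ i → i ∈ A × x ∈B blk B i × y ∈B blk B i))

{-# OPTIONS --safe #-}
-- Add three points ∞₀, ∞₁, ∞₂ to the 12n points of the frame and fill every group Vᵢ, together with the ∞'s,
-- with a copy of a KTS(15) that has {∞₀, ∞₁, ∞₂} as a block and a sub-STS(7) on Wᵢ ∪ {∞₀}; the ∞-block itself
-- is used only once.  Counting the frame blocks through a point in two ways (once per partial class missing its
-- group, and once per point outside its group) shows that, for n ≥ 2, each group is the hole of exactly six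
-- partial classes.  These are completed by the six parallel classes of the copy on that group that avoid the
-- ∞-block, while the remaining class of every copy, together with the ∞-block, forms one further parallel
-- class.  The sub-STS(7)s and the 3-GDD of type 6ⁿ on W make up an STS(6n+1) on W ∪ {∞₀}.  For n = 1 the
-- KTS(15) itself is the required system.
module Submission where

open import Data.Bool using (Bool; true; false; if_then_else_)
import Data.Bool as Bool
open import Data.Empty using (⊥-elim)
open import Data.Nat using (ℕ; zero; suc; _+_; _*_; _≤_)
import Data.Nat as ℕ
open import Data.Nat.Properties
  using (+-0-commutativeMonoid; +-identityʳ; +-assoc; +-comm; *-zeroʳ; *-identityʳ; *-comm; *-suc; *-distribˡ-+;
         +-cancelˡ-≡; +-cancelʳ-≡; *-cancelˡ-≡; suc-injective; m+n≡0⇒n≡0)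
open import Data.Fin using (Fin; zero; suc; #_; cast; _↑ˡ_; _↑ʳ_; splitAt; join; remQuot; quotRem)
open import Data.Fin.Properties
  using (_≟_; all?; any?; cast-involutive; splitAt-↑ˡ; splitAt-↑ʳ; splitAt⁻¹-↑ˡ; splitAt⁻¹-↑ʳ; join-splitAt;
         ↑ˡ-injective; ↑ʳ-injective)
import Data.Fin.Properties as Fin
open import Data.Fin.Subset using (Subset; _∈_; _∉_; _∩_; ∣_∣; ⁅_⁆; inside; outside)
open import Data.Fin.Subset.Properties using (_∈?_; x∈p∩q⁺; x∈p∩q⁻; x∈⁅y⁆⇒x≡y)
open import Data.List using (List; length; tabulate)
open import Data.List.Properties using (length-tabulate; lookup-tabulate)
open import Data.Vec using (Vec; []; _∷_; _++_; lookup)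
import Data.Vec as Vec
open import Data.Vec.Properties using (lookup∘tabulate; []=⇒lookup; lookup⇒[]=; lookup-++ˡ; lookup-++ʳ)
open import Data.Product using (Σ; ∃; _×_; _,_; proj₁; proj₂; map₂; uncurry)
import Data.Product as Product
open import Data.Sum using (_⊎_; inj₁; inj₂; [_,_]′)
import Data.Sum as Sum
open import Function using (_∘_; _∘′_; _$_)
open import Function.Definitions using (Injective)
open import Relation.Nullary using (Dec; yes; no; ¬_; does)
open import Relation.Nullary.Decidable using (_×-dec_; _⊎-dec_; _→-dec_; ¬?; ⌊_⌋; toWitness)
open import Relation.Unary using (Decidable)
open import Relation.Binary.PropositionalEquality

open import Defs

open import Algebra.Properties.CommutativeMonoid.Sum +-0-commutativeMonoid
  using (sum; ∑-distrib-+; ∑-comm; sum-cong-≗)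

private
  variable
    P Q : Set
    a b k v : ℕ

𝟙 : Dec P → ℕ
𝟙 d = if does d then 1 else 0

𝟙-yes : (d : Dec P) → P → 𝟙 d ≡ 1
𝟙-yes (yes _) _ = refl
𝟙-yes (no ¬p) p = ⊥-elim (¬p p)

𝟙-no : (d : Dec P) → ¬ P → 𝟙 d ≡ 0
𝟙-no (yes p) ¬p = ⊥-elim (¬p p)
𝟙-no (no _) _ = refl

𝟙-cong : (d : Dec P) (e : Dec Q) → (P → Q) → (Q → P) → 𝟙 d ≡ 𝟙 e
𝟙-cong (yes p) e to from = sym (𝟙-yes e (to p))
𝟙-cong (no ¬p) e to from = sym (𝟙-no e (¬p ∘ from))

𝟙-⊎ : (d : Dec P) (e : Dec Q) (f : Dec (P ⊎ Q)) → ¬ (P × Q) → 𝟙 f ≡ 𝟙 d + 𝟙 e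
𝟙-⊎ (yes a) (yes b) f disjoint = ⊥-elim (disjoint (a , b))
𝟙-⊎ (yes a) (no _)  f _ = 𝟙-yes f (inj₁ a)
𝟙-⊎ (no _)  (yes b) f _ = 𝟙-yes f (inj₂ b)
𝟙-⊎ (no a)  (no b)  f _ = 𝟙-no f [ a , b ]′

𝟙+𝟙-¬ : (d : Dec P) → 𝟙 d + 𝟙 (¬? d) ≡ 1
𝟙+𝟙-¬ (yes _) = refl
𝟙+𝟙-¬ (no _) = refl

𝟙-split : (d : Dec P) (e : Dec Q) → 𝟙 d ≡ 𝟙 (d ×-dec e) + 𝟙 (d ×-dec ¬? e)
𝟙-split (yes _) (yes _) = refl
𝟙-split (yes _) (no _) = refl
𝟙-split (no _) _ = refl

sum-zero : (f : Fin k → ℕ) → (∀ i → f i ≡ 0) → sum f ≡ 0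
sum-zero {zero} f f≡0 = refl
sum-zero {suc k} f f≡0 rewrite f≡0 zero = sum-zero (f ∘ suc) (f≡0 ∘ suc)

sum-single : (f : Fin k → ℕ) (a : Fin k) → (∀ i → i ≢ a → f i ≡ 0) → sum f ≡ f a
sum-single {suc k} f zero rest =
  trans (cong (f zero +_) (sum-zero (f ∘ suc) (λ i → rest (suc i) λ ()))) (+-identityʳ _)
sum-single {suc k} f (suc a) rest rewrite rest zero (λ ()) =
  sum-single (f ∘ suc) a (λ i i≢a → rest (suc i) (i≢a ∘ Fin.suc-injective))

sum-const : (c : ℕ) → sum {k} (λ _ → c) ≡ k * c
sum-const {zero} c = refl
sum-const {suc k} c = cong (c +_) (sum-const {k} c)

sum-*ˡ : (c : ℕ) (f : Fin k → ℕ) → sum (λ i → c * f i) ≡ c * sum f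
sum-*ˡ {zero} c f = sym (*-zeroʳ c)
sum-*ˡ {suc k} c f =
  trans (cong (c * f zero +_) (sum-*ˡ c (f ∘ suc))) (sym (*-distribˡ-+ c (f zero) _))

sum-splitAt : ∀ a {b} (h : Fin a ⊎ Fin b → ℕ) →
  sum (h ∘′ splitAt a) ≡ sum (h ∘′ inj₁) + sum (h ∘′ inj₂)
sum-splitAt zero h = refl
sum-splitAt (suc a) h =
  trans (cong (h (inj₁ zero) +_) (sum-splitAt a (h ∘ Sum.map₁ suc))) (sym (+-assoc (h (inj₁ zero)) _ _))

sum-remQuot : ∀ n k (h : Fin n × Fin k → ℕ) →
  sum (h ∘′ remQuot {n} k) ≡ sum (λ i → sum (λ j → h (i , j)))
sum-remQuot zero k h = refl
sum-remQuot (suc n) k h =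
  trans (sum-splitAt k (h ∘ Product.swap ∘ [ (λ j → j , zero) , map₂ suc ∘ quotRem {n} k ]′))
        (cong (sum (λ j → h (zero , j)) +_) (sum-remQuot n k (λ (i , j) → h (suc i , j))))

count : {P : Fin k → Set} → Decidable P → ℕ
count P? = sum (λ i → 𝟙 (P? i))

module _ {P : Fin k → Set} (P? : Decidable P) where

  ExactlyOne⇒count≡1 : ExactlyOne P → count P? ≡ 1
  ExactlyOne⇒count≡1 (a , pa , unique) =
    trans (sum-single _ a (λ i i≢a → 𝟙-no (P? i) (i≢a ∘ unique i))) (𝟙-yes (P? a) pa)

  NoneSat⇒count≡0 : NoneSat P → count P? ≡ 0
  NoneSat⇒count≡0 none = sum-zero _ (λ i → 𝟙-no (P? i) (none i))

  count+count-¬≡k : count P? + count (¬? ∘ P?) ≡ k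
  count+count-¬≡k =
    trans (sym (∑-distrib-+ (λ i → 𝟙 (P? i)) (λ i → 𝟙 (¬? (P? i)))))
          (trans (sum-cong-≗ (𝟙+𝟙-¬ ∘ P?)) (trans (sum-const {k} 1) (*-identityʳ k)))

count-split : {P Q : Fin k → Set} (P? : Decidable P) (Q? : Decidable Q) →
  count P? ≡ count (λ i → P? i ×-dec Q? i) + count (λ i → P? i ×-dec ¬? (Q? i))
count-split P? Q? = trans (sum-cong-≗ (λ i → 𝟙-split (P? i) (Q? i)))
  (∑-distrib-+ (λ i → 𝟙 (P? i ×-dec Q? i)) (λ i → 𝟙 (P? i ×-dec ¬? (Q? i))))

count-on-diagonal : ∀ {P : Set} (c₀ : Fin k) (d : Dec P) → count (λ c → (c₀ ≟ c) ×-dec d) ≡ 𝟙 d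
count-on-diagonal c₀ d@(yes p) =
  ExactlyOne⇒count≡1 (λ c → (c₀ ≟ c) ×-dec d) (c₀ , (refl , p) , λ _ (e , _) → sym e)
count-on-diagonal c₀ d@(no ¬p) = NoneSat⇒count≡0 (λ c → (c₀ ≟ c) ×-dec d) (λ _ (_ , p) → ¬p p)

count≡0⇒NoneSat : {P : Fin k → Set} (P? : Decidable P) → count P? ≡ 0 → NoneSat P
count≡0⇒NoneSat {suc k} P? c≡0 zero p0 with P? zero
... | no ¬p0 = ¬p0 p0
count≡0⇒NoneSat {suc k} P? c≡0 (suc i) pi =
  count≡0⇒NoneSat (P? ∘ suc) (m+n≡0⇒n≡0 (𝟙 (P? zero)) c≡0) i pi

count≡1⇒ExactlyOne : {P : Fin k → Set} (P? : Decidable P) → count P? ≡ 1 → ExactlyOne P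
count≡1⇒ExactlyOne {suc k} {P = P} P? c≡1 with P? zero
... | yes p0 = zero , p0 , unique
  where
  unique : ∀ j → P j → j ≡ zero
  unique zero _ = refl
  unique (suc j) pj = ⊥-elim (count≡0⇒NoneSat (P? ∘ suc) (suc-injective c≡1) j pj)
... | no ¬p0 with count≡1⇒ExactlyOne (P? ∘ suc) c≡1
...   | a , pa , unique = suc a , pa , unique′
  where
  unique′ : ∀ j → P j → j ≡ suc a
  unique′ zero p0 = ⊥-elim (¬p0 p0)
  unique′ (suc j) pj = cong suc (unique j pj)

count≡suc⇒∃ : {P : Fin k → Set} (P? : Decidable P) → ∀ {c} → count P? ≡ suc c → ∃ P
count≡suc⇒∃ {suc k} P? c≡suc with P? zero
... | yes p0 = zero , p0
... | no _ = Product.map suc (λ p → p) (count≡suc⇒∃ (P? ∘ suc) c≡suc)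

∣p∣≡count-∈ : ∀ {n} (s : Subset n) → ∣ s ∣ ≡ count (_∈? s)
∣p∣≡count-∈ [] = refl
∣p∣≡count-∈ (inside ∷ s) = cong suc (∣p∣≡count-∈ s)
∣p∣≡count-∈ (outside ∷ s) = ∣p∣≡count-∈ s

record Enumeration {N} (P : Fin N → Set) (k : ℕ) : Set where
  field
    elem : Fin k → Fin N
    elem-sat : ∀ j → P (elem j)
    elem-injective : ∀ j j′ → elem j ≡ elem j′ → j ≡ j′
    index : ∀ x → P x → Fin k
    elem-index : ∀ x px → elem (index x px) ≡ x

enumerate : ∀ {N} {P : Fin N → Set} (P? : Decidable P) → Enumeration P (count P?)
enumerate {zero} P? = record
  { elem = λ () ; elem-sat = λ () ; elem-injective = λ () ; index = λ () ; elem-index = λ () }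
enumerate {suc N} {P} P? with P? zero | enumerate (P? ∘ suc)
... | yes p0 | E = record
  { elem = elem ; elem-sat = elem-sat ; elem-injective = elem-injective
  ; index = index ; elem-index = elem-index }
  where
  module E = Enumeration E
  elem : Fin (suc _) → Fin (suc N)
  elem zero = zero
  elem (suc j) = suc (E.elem j)
  elem-sat : ∀ j → P (elem j)
  elem-sat zero = p0
  elem-sat (suc j) = E.elem-sat j
  elem-injective : ∀ j j′ → elem j ≡ elem j′ → j ≡ j′
  elem-injective zero zero _ = refl
  elem-injective zero (suc j′) ()
  elem-injective (suc j) zero ()
  elem-injective (suc j) (suc j′) eq =
    cong suc (E.elem-injective j j′ (Fin.suc-injective eq))
  index : ∀ x → P x → Fin (suc _)
  index zero _ = zero
  index (suc x) px = suc (E.index x px)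
  elem-index : ∀ x px → elem (index x px) ≡ x
  elem-index zero _ = refl
  elem-index (suc x) px = cong suc (E.elem-index x px)
... | no ¬p0 | E = record
  { elem = suc ∘ E.elem ; elem-sat = E.elem-sat
  ; elem-injective = λ j j′ eq → E.elem-injective j j′ (Fin.suc-injective eq)
  ; index = index ; elem-index = elem-index }
  where
  module E = Enumeration E
  index : ∀ x → P x → Fin _
  index zero p0 = ⊥-elim (¬p0 p0)
  index (suc x) px = E.index x px
  elem-index : ∀ x px → suc (E.elem (index x px)) ≡ x
  elem-index zero p0 = ⊥-elim (¬p0 p0)
  elem-index (suc x) px = cong suc (E.elem-index x px)

Enumeration-cast : ∀ {N} {P : Fin N → Set} {k′} → k ≡ k′ → Enumeration P k → Enumeration P k′
Enumeration-cast {k = k} {k′ = k′} k≡k′ E = record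
  { elem = E.elem ∘ cast (sym k≡k′)
  ; elem-sat = E.elem-sat ∘ cast (sym k≡k′)
  ; elem-injective = λ j j′ e → trans (sym (cast-involutive k≡k′ (sym k≡k′) j))
      (trans (cong (cast k≡k′) (E.elem-injective _ _ e)) (cast-involutive k≡k′ (sym k≡k′) j′))
  ; index = λ x px → cast k≡k′ (E.index x px)
  ; elem-index = λ x px → trans (cong E.elem (cast-involutive (sym k≡k′) k≡k′ _)) (E.elem-index x px) }
  where module E = Enumeration E

opaque
  enumerate-≡ : ∀ {N} {P : Fin N → Set} (P? : Decidable P) → count P? ≡ k → Enumeration P k
  enumerate-≡ P? count≡k = Enumeration-cast count≡k (enumerate P?)

↑ˡ≢↑ʳ : ∀ {m n} (i : Fin m) (j : Fin n) → i ↑ˡ n ≢ m ↑ʳ j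
↑ˡ≢↑ʳ {m} {n} i j e with trans (sym (splitAt-↑ˡ m i n)) (trans (cong (splitAt m) e) (splitAt-↑ʳ m n j))
... | ()

module _ {a b c} {f : Fin a → Fin c} {g : Fin b → Fin c} where

  [,]∘splitAt-injective : Injective _≡_ _≡_ f → Injective _≡_ _≡_ g → (∀ u v → f u ≢ g v) →
    Injective _≡_ _≡_ ([ f , g ]′ ∘′ splitAt a)
  [,]∘splitAt-injective f-inj g-inj f≢g {k} {k′} e with splitAt a k in sk | splitAt a k′ in sk′
  ... | inj₁ u | inj₁ u′ =
    trans (sym (splitAt⁻¹-↑ˡ sk)) (trans (cong (_↑ˡ b) (f-inj e)) (splitAt⁻¹-↑ˡ sk′))
  ... | inj₁ u | inj₂ v′ = ⊥-elim (f≢g u v′ e)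
  ... | inj₂ v | inj₁ u′ = ⊥-elim (f≢g u′ v (sym e))
  ... | inj₂ v | inj₂ v′ =
    trans (sym (splitAt⁻¹-↑ʳ sk)) (trans (cong (a ↑ʳ_) (g-inj e)) (splitAt⁻¹-↑ʳ sk′))

_∈B?_ : (x : Fin v) (t : Block v) → Dec (x ∈B t)
x ∈B? (a , b , c) = (x ≟ a) ⊎-dec (x ≟ b) ⊎-dec (x ≟ c)

pair∈? : (x y : Fin v) (t : Block v) → Dec (x ∈B t × y ∈B t)
pair∈? x y t = x ∈B? t ×-dec y ∈B? t

mapBlock : (Fin a → Fin b) → Block a → Block b
mapBlock f (x , y , z) = f x , f y , f z

module _ (f : Fin a → Fin b) where

  ∈B-map : ∀ t {k} → k ∈B t → f k ∈B mapBlock f t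
  ∈B-map t (inj₁ refl) = inj₁ refl
  ∈B-map t (inj₂ (inj₁ refl)) = inj₂ (inj₁ refl)
  ∈B-map t (inj₂ (inj₂ refl)) = inj₂ (inj₂ refl)

  ∈B-map⁻ : ∀ t {y} → y ∈B mapBlock f t → ∃ λ k → y ≡ f k × k ∈B t
  ∈B-map⁻ (x , _ , _) (inj₁ e) = x , e , inj₁ refl
  ∈B-map⁻ (_ , y , _) (inj₂ (inj₁ e)) = y , e , inj₂ (inj₁ refl)
  ∈B-map⁻ (_ , _ , z) (inj₂ (inj₂ e)) = z , e , inj₂ (inj₂ refl)

  ∉B-map : ∀ {y} → (∀ k → f k ≢ y) → ∀ t → ¬ y ∈B mapBlock f t
  ∉B-map f≢y t y∈ with ∈B-map⁻ t y∈
  ... | k , y≡fk , _ = f≢y k (sym y≡fk)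

  module _ (f-inj : Injective _≡_ _≡_ f) where

    ∈B-map-injective : ∀ t {k} → f k ∈B mapBlock f t → k ∈B t
    ∈B-map-injective t fk∈ with ∈B-map⁻ t fk∈
    ... | k′ , fk≡fk′ , k′∈ = subst (_∈B t) (sym (f-inj fk≡fk′)) k′∈

    IsTriple-map : ∀ t → IsTriple t → IsTriple (mapBlock f t)
    IsTriple-map t (x≢y , x≢z , y≢z) = x≢y ∘ f-inj , x≢z ∘ f-inj , y≢z ∘ f-inj


    𝟙-pair∈-map : ∀ t k l → 𝟙 (pair∈? (f k) (f l) (mapBlock f t)) ≡ 𝟙 (pair∈? k l t)
    𝟙-pair∈-map t k l = 𝟙-cong (pair∈? (f k) (f l) (mapBlock f t)) (pair∈? k l t)
      (λ (k∈ , l∈) → ∈B-map-injective t k∈ , ∈B-map-injective t l∈)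
      (λ (k∈ , l∈) → ∈B-map t k∈ , ∈B-map t l∈)

𝟙-pair∈-sym : (x y : Fin v) (t : Block v) → 𝟙 (pair∈? x y t) ≡ 𝟙 (pair∈? y x t)
𝟙-pair∈-sym x y t = 𝟙-cong (pair∈? x y t) (pair∈? y x t) (λ (p , q) → q , p) (λ (p , q) → q , p)

module _ {u : ℕ} (G : Fin v → Fin u) where

  Transversal⇒IsTriple : ∀ t → Transversal G t → IsTriple t
  Transversal⇒IsTriple (x , y , z) (gx≢gy , gx≢gz , gy≢gz) =
    gx≢gy ∘ cong G , gx≢gz ∘ cong G , gy≢gz ∘ cong G

  Transversal-injective : ∀ t → Transversal G t → ∀ {x y} → x ∈B t → y ∈B t → G x ≡ G y → x ≡ y
  Transversal-injective _ _ (inj₁ refl) (inj₁ refl) _ = refl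
  Transversal-injective _ (ab , _ , _) (inj₁ refl) (inj₂ (inj₁ refl)) e = ⊥-elim (ab e)
  Transversal-injective _ (_ , ac , _) (inj₁ refl) (inj₂ (inj₂ refl)) e = ⊥-elim (ac e)
  Transversal-injective _ (ab , _ , _) (inj₂ (inj₁ refl)) (inj₁ refl) e = ⊥-elim (ab (sym e))
  Transversal-injective _ _ (inj₂ (inj₁ refl)) (inj₂ (inj₁ refl)) _ = refl
  Transversal-injective _ (_ , _ , bc) (inj₂ (inj₁ refl)) (inj₂ (inj₂ refl)) e = ⊥-elim (bc e)
  Transversal-injective _ (_ , ac , _) (inj₂ (inj₂ refl)) (inj₁ refl) e = ⊥-elim (ac (sym e))
  Transversal-injective _ (_ , _ , bc) (inj₂ (inj₂ refl)) (inj₂ (inj₁ refl)) e = ⊥-elim (bc (sym e))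
  Transversal-injective _ _ (inj₂ (inj₂ refl)) (inj₂ (inj₂ refl)) _ = refl

count-≡ : (p : Fin v) → count (_≟ p) ≡ 1
count-≡ p = ExactlyOne⇒count≡1 (_≟ p) (p , refl , λ _ e → e)

count-two : {P : Fin v → Set} (P? : Decidable P) {p q : Fin v} → p ≢ q →
  (∀ y → P y → y ≡ p ⊎ y ≡ q) → (∀ y → y ≡ p ⊎ y ≡ q → P y) → count P? ≡ 2
count-two P? {p} {q} p≢q to from = begin
  count P?
    ≡⟨ sum-cong-≗ (λ y → 𝟙-cong (P? y) (p∨q y) (to y) (from y)) ⟩
  sum (λ y → 𝟙 (p∨q y))
    ≡⟨ sum-cong-≗ (λ y → 𝟙-⊎ (y ≟ p) (y ≟ q) (p∨q y) (λ (e₁ , e₂) → p≢q (trans (sym e₁) e₂))) ⟩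
  sum (λ y → 𝟙 (y ≟ p) + 𝟙 (y ≟ q))
    ≡⟨ ∑-distrib-+ (λ y → 𝟙 (y ≟ p)) (λ y → 𝟙 (y ≟ q)) ⟩
  count (_≟ p) + count (_≟ q)
    ≡⟨ cong₂ _+_ (count-≡ p) (count-≡ q) ⟩
  2 ∎
  where
  open ≡-Reasoning
  p∨q : ∀ y → Dec (y ≡ p ⊎ y ≡ q)
  p∨q y = (y ≟ p) ⊎-dec (y ≟ q)

others : (t : Block v) (x : Fin v) → Decidable (λ y → y ∈B t × y ≢ x)
others t x y = y ∈B? t ×-dec ¬? (y ≟ x)

count-others∈triple : ∀ t → IsTriple t → ∀ {x : Fin v} → x ∈B t → count (others t x) ≡ 2
count-others∈triple (a , b , c) (ab , ac , bc) (inj₁ refl) = count-two (others (a , b , c) a) bc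
  (λ { y (inj₁ e , y≢x) → ⊥-elim (y≢x e) ; y (inj₂ (inj₁ e) , _) → inj₁ e ; y (inj₂ (inj₂ e) , _) → inj₂ e })
  (λ { y (inj₁ refl) → inj₂ (inj₁ refl) , ab ∘ sym ; y (inj₂ refl) → inj₂ (inj₂ refl) , ac ∘ sym })
count-others∈triple (a , b , c) (ab , ac , bc) (inj₂ (inj₁ refl)) = count-two (others (a , b , c) b) ac
  (λ { y (inj₁ e , _) → inj₁ e ; y (inj₂ (inj₁ e) , y≢x) → ⊥-elim (y≢x e) ; y (inj₂ (inj₂ e) , _) → inj₂ e })
  (λ { y (inj₁ refl) → inj₁ refl , ab ; y (inj₂ refl) → inj₂ (inj₂ refl) , bc ∘ sym })
count-others∈triple (a , b , c) (ab , ac , bc) (inj₂ (inj₂ refl)) = count-two (others (a , b , c) c) ab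
  (λ { y (inj₁ e , _) → inj₁ e ; y (inj₂ (inj₁ e) , _) → inj₂ e ; y (inj₂ (inj₂ e) , y≢x) → ⊥-elim (y≢x e) })
  (λ { y (inj₁ refl) → inj₁ refl , ac ; y (inj₂ refl) → inj₂ (inj₁ refl) , bc })

ExactlyOne-transport : ∀ {K K′} (σ : Fin K′ → Fin K) (τ : Fin K → Fin K′) →
  (∀ i → σ (τ i) ≡ i) → (∀ j → τ (σ j) ≡ j) →
  {P : Fin K → Set} {Q : Fin K′ → Set} → (∀ j → Q j → P (σ j)) → (∀ j → P (σ j) → Q j) →
  ExactlyOne P → ExactlyOne Q
ExactlyOne-transport σ τ στ τσ {P} Q⇒P P⇒Q (i , pi , unique) =
  τ i , P⇒Q (τ i) (subst P (sym (στ i)) pi) , λ j qj → trans (sym (τσ j)) (cong τ (unique (σ j) (Q⇒P j qj)))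

record KTSWithSubByCounts (v K m : ℕ) : Set where
  field
    block : Fin K → Block v
    class : Fin K → Fin m
    sub : Subset v
    inSub : Fin K → Bool
    triple : ∀ i → IsTriple (block i)
    pairs : ∀ x y → x ≢ y → count (λ i → pair∈? x y (block i)) ≡ 1
    classes : ∀ c x → count (λ i → (class i ≟ c) ×-dec x ∈B? block i) ≡ 1
    sub-closed : ∀ i → inSub i ≡ true → ∀ x → x ∈B block i → x ∈ sub
    sub-pairs : ∀ x y → x ∈ sub → y ∈ sub → x ≢ y →
      count (λ i → (inSub i Bool.≟ true) ×-dec pair∈? x y (block i)) ≡ 1

  blocks : List (Block v)
  blocks = tabulate block

  private
    e : length blocks ≡ K
    e = length-tabulate block

    σ : Fin (length blocks) → Fin K
    σ = cast e

    τ : Fin K → Fin (length blocks)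
    τ = cast (sym e)

    στ : ∀ i → σ (τ i) ≡ i
    στ = cast-involutive e (sym e)

    τσ : ∀ j → τ (σ j) ≡ j
    τσ = cast-involutive (sym e) e

    blk≡ : ∀ j → blk blocks j ≡ block (σ j)
    blk≡ j = trans (cong (blk blocks) (sym (τσ j))) (lookup-tabulate block (σ j))

    to : ∀ {x} j → x ∈B blk blocks j → x ∈B block (σ j)
    to j = subst (_ ∈B_) (blk≡ j)

    from : ∀ {x} j → x ∈B block (σ j) → x ∈B blk blocks j
    from j = subst (_ ∈B_) (sym (blk≡ j))

    D : Subset (length blocks)
    D = Vec.tabulate (inSub ∘ σ)

    ∈D⇒ : ∀ j → j ∈ D → inSub (σ j) ≡ true
    ∈D⇒ j j∈D = trans (sym (lookup∘tabulate (inSub ∘ σ) j)) ([]=⇒lookup j∈D)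

    ⇒∈D : ∀ j → inSub (σ j) ≡ true → j ∈ D
    ⇒∈D j s = lookup⇒[]= j D (trans (lookup∘tabulate (inSub ∘ σ) j) s)

  isKTS : IsKTS v blocks
  isKTS = (triple′ , pairs′) , (m , class ∘ σ , classes′)
    where
    triple′ : ∀ j → IsTriple (blk blocks j)
    triple′ j = subst IsTriple (sym (blk≡ j)) (triple (σ j))
    pairs′ : ∀ x y → x ≢ y → ExactlyOne (λ j → x ∈B blk blocks j × y ∈B blk blocks j)
    pairs′ x y x≢y = ExactlyOne-transport σ τ στ τσ
      (λ j (p , q) → to j p , to j q) (λ j (p , q) → from j p , from j q)
      (count≡1⇒ExactlyOne (λ i → pair∈? x y (block i)) (pairs x y x≢y))
    classes′ : ∀ c x → ExactlyOne (λ j → class (σ j) ≡ c × x ∈B blk blocks j)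
    classes′ c x = ExactlyOne-transport σ τ στ τσ
      (λ j (p , q) → p , to j q) (λ j (p , q) → p , from j q)
      (count≡1⇒ExactlyOne (λ i → (class i ≟ c) ×-dec x ∈B? block i) (classes c x))

  hasSubSTS : HasSubSTS blocks ∣ sub ∣
  hasSubSTS = sub , D , refl , closed , pairs′
    where
    closed : ∀ j → j ∈ D → ∀ x → x ∈B blk blocks j → x ∈ sub
    closed j j∈D x x∈ = sub-closed (σ j) (∈D⇒ j j∈D) x (to j x∈)
    pairs′ : ∀ x y → x ∈ sub → y ∈ sub → x ≢ y →
      ExactlyOne (λ j → j ∈ D × x ∈B blk blocks j × y ∈B blk blocks j)
    pairs′ x y x∈ y∈ x≢y = ExactlyOne-transport σ τ στ τσ
      (λ j (d , p , q) → ∈D⇒ j d , to j p , to j q) (λ j (d , p , q) → ⇒∈D j d , from j p , from j q)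
      (count≡1⇒ExactlyOne (λ i → (inSub i Bool.≟ true) ×-dec pair∈? x y (block i)) (sub-pairs x y x∈ y∈ x≢y))

-- Double counting in a Kirkman frame

∈groupSet⁺ : ∀ {N u} (G : Fin N → Fin u) {i x} → G x ≡ i → x ∈ groupSet G i
∈groupSet⁺ G {i} {x} Gx≡i = lookup⇒[]= x (groupSet G i) (trans (lookup∘tabulate _ x) (lemma (G x ≟ i)))
  where
  lemma : (d : Dec (G x ≡ i)) → ⌊ d ⌋ ≡ true
  lemma (yes _) = refl
  lemma (no Gx≢i) = ⊥-elim (Gx≢i Gx≡i)

∈groupSet⁻ : ∀ {N u} (G : Fin N → Fin u) {i x} → x ∈ groupSet G i → G x ≡ i
∈groupSet⁻ G {i} {x} x∈ = lemma (G x ≟ i) (trans (sym (lookup∘tabulate _ x)) ([]=⇒lookup x∈))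
  where
  lemma : (d : Dec (G x ≡ i)) → ⌊ d ⌋ ≡ true → G x ≡ i
  lemma (yes Gx≡i) _ = Gx≡i

module FrameCounting {h u : ℕ} (G : Fin (h * u) → Fin u) (B : List (Block (h * u)))
  (frame : IsKirkmanFrame h u G B) where

  private
    N = h * u

  m : ℕ
  m = proj₁ (proj₂ frame)

  cls : Idx B → Fin m
  cls = proj₁ (proj₂ (proj₂ frame))

  hole : Fin m → Fin u
  hole = proj₁ (proj₂ (proj₂ (proj₂ frame)))

  group-size : ∀ i → ∣ groupSet G i ∣ ≡ h
  group-size = proj₁ (proj₁ frame)

  transversal : ∀ b → Transversal G (blk B b)
  transversal = proj₁ (proj₂ (proj₁ frame))

  pairs : ∀ x y → G x ≢ G y → ExactlyOne (λ b → x ∈B blk B b × y ∈B blk B b)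
  pairs = proj₂ (proj₂ (proj₁ frame))

  resolution : ∀ c x →
    (G x ≡ hole c → NoneSat (λ b → cls b ≡ c × x ∈B blk B b)) ×
    (G x ≢ hole c → ExactlyOne (λ b → cls b ≡ c × x ∈B blk B b))
  resolution = proj₂ (proj₂ (proj₂ (proj₂ frame)))

  holes : Fin u → ℕ
  holes g = count (λ c → hole c ≟ g)

  count-group : ∀ i → count (λ x → G x ≟ i) ≡ h
  count-group i = begin
    count (λ x → G x ≟ i)
      ≡⟨ sum-cong-≗ (λ x → 𝟙-cong (G x ≟ i) (x ∈? groupSet G i) (∈groupSet⁺ G) (∈groupSet⁻ G)) ⟩
    count (_∈? groupSet G i) ≡⟨ sym (∣p∣≡count-∈ (groupSet G i)) ⟩
    ∣ groupSet G i ∣         ≡⟨ group-size i ⟩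
    h                        ∎
    where open ≡-Reasoning

  replication : Fin N → ℕ
  replication x = count (λ b → x ∈B? blk B b)

  replication≡non-holes : ∀ x → replication x ≡ count (λ c → ¬? (hole c ≟ G x))
  replication≡non-holes x = begin
    replication x
      ≡⟨ sum-cong-≗ (λ b → sym (count-on-diagonal (cls b) (x ∈B? blk B b))) ⟩
    sum (λ b → count (λ c → in-class b c))
      ≡⟨ ∑-comm (λ b c → 𝟙 (in-class b c)) ⟩
    sum (λ c → count (λ b → in-class b c))
      ≡⟨ sum-cong-≗ class-covers ⟩
    count (λ c → ¬? (hole c ≟ G x)) ∎
    where
    open ≡-Reasoning
    in-class : ∀ b c → Dec (cls b ≡ c × x ∈B blk B b)
    in-class b c = (cls b ≟ c) ×-dec x ∈B? blk B b

    class-covers : ∀ c → count (λ b → in-class b c) ≡ 𝟙 (¬? (hole c ≟ G x))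
    class-covers c with hole c ≟ G x
    ... | yes hc≡Gx = NoneSat⇒count≡0 (λ b → in-class b c) (proj₁ (resolution c x) (sym hc≡Gx))
    ... | no hc≢Gx = ExactlyOne⇒count≡1 (λ b → in-class b c) (proj₂ (resolution c x) (hc≢Gx ∘ sym))

  2*replication≡outside-group : ∀ x → 2 * replication x ≡ count (λ y → ¬? (G y ≟ G x))
  2*replication≡outside-group x = begin
    2 * replication x                     ≡⟨ sym (sum-*ˡ 2 (λ b → 𝟙 (x ∈B? blk B b))) ⟩
    sum (λ b → 2 * 𝟙 (x ∈B? blk B b))     ≡⟨ sum-cong-≗ (λ b → sym (flags-at-block b)) ⟩
    sum (λ b → sum (λ y → flag b y))      ≡⟨ ∑-comm flag ⟩
    sum (λ y → sum (λ b → flag b y))      ≡⟨ sum-cong-≗ flags-at-point ⟩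
    count (λ y → ¬? (G y ≟ G x))          ∎
    where
    open ≡-Reasoning
    flag : Idx B → Fin N → ℕ
    flag b y = 𝟙 (x ∈B? blk B b ×-dec others (blk B b) x y)

    flags-at-block : ∀ b → sum (flag b) ≡ 2 * 𝟙 (x ∈B? blk B b)
    flags-at-block b = helper (x ∈B? blk B b)
      where
      helper : (d : Dec (x ∈B blk B b)) → sum (λ y → 𝟙 (d ×-dec others (blk B b) x y)) ≡ 2 * 𝟙 d
      helper d@(yes x∈) = trans
        (sum-cong-≗ (λ y → 𝟙-cong (d ×-dec others (blk B b) x y) (others (blk B b) x y) proj₂ (x∈ ,_)))
        (count-others∈triple (blk B b) (Transversal⇒IsTriple G (blk B b) (transversal b)) x∈)
      helper d@(no x∉) = sum-zero _ (λ y → 𝟙-no (d ×-dec others (blk B b) x y) (x∉ ∘ proj₁))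

    flags-at-point : ∀ y → sum (λ b → flag b y) ≡ 𝟙 (¬? (G y ≟ G x))
    flags-at-point y with G y ≟ G x
    ... | yes Gy≡Gx = NoneSat⇒count≡0 (λ b → x ∈B? blk B b ×-dec others (blk B b) x y)
      (λ b (x∈ , y∈ , y≢x) → y≢x (Transversal-injective G (blk B b) (transversal b) y∈ x∈ Gy≡Gx))
    ... | no Gy≢Gx with pairs x y (Gy≢Gx ∘ sym)
    ...   | b , (x∈ , y∈) , unique = ExactlyOne⇒count≡1 (λ b → x ∈B? blk B b ×-dec others (blk B b) x y)
      (b , (x∈ , y∈ , Gy≢Gx ∘ cong G) , λ b′ (x∈′ , y∈′ , _) → unique b′ (x∈′ , y∈′))

  2*non-holes+h≡N : ∀ x → 2 * count (λ c → ¬? (hole c ≟ G x)) + h ≡ N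
  2*non-holes+h≡N x = begin
    2 * count (λ c → ¬? (hole c ≟ G x)) + h  ≡⟨ cong (λ r → 2 * r + h) (sym (replication≡non-holes x)) ⟩
    2 * replication x + h                    ≡⟨ cong (_+ h) (2*replication≡outside-group x) ⟩
    off-group + h                            ≡⟨ +-comm off-group h ⟩
    h + off-group                            ≡⟨ cong (_+ off-group) (sym (count-group (G x))) ⟩
    count (λ y → G y ≟ G x) + off-group      ≡⟨ count+count-¬≡k (λ y → G y ≟ G x) ⟩
    N                                        ∎
    where
    open ≡-Reasoning
    off-group : ℕ
    off-group = count (λ y → ¬? (G y ≟ G x))

  sum-holes : sum holes ≡ m
  sum-holes = begin
    sum (λ g → count (λ c → hole c ≟ g)) ≡⟨ ∑-comm (λ g c → 𝟙 (hole c ≟ g)) ⟩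
    sum (λ c → count (hole c ≟_))
      ≡⟨ sum-cong-≗ (λ c → ExactlyOne⇒count≡1 (hole c ≟_) (hole c , refl , λ _ e → sym e)) ⟩
    sum {m} (λ _ → 1)                    ≡⟨ sum-const {m} 1 ⟩
    m * 1                                ≡⟨ *-identityʳ m ⟩
    m                                    ∎
    where open ≡-Reasoning

holes-per-group : ∀ {h′ u′} {G : Fin (suc h′ * suc (suc u′)) → Fin (suc (suc u′))} {B}
  (frame : IsKirkmanFrame (suc h′) (suc (suc u′)) G B) → ∀ g → 2 * FrameCounting.holes G B frame g ≡ suc h′
holes-per-group {h′} {u′} {G} {B} frame g = trans (all-equal g) 2*holes₀≡h
  where
  open FrameCounting G B frame
  h = suc h′
  c = h * suc u′

  non-holes : ∀ g → 2 * count (λ c → ¬? (hole c ≟ g)) ≡ c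
  non-holes g with count≡suc⇒∃ (λ x → G x ≟ g) (count-group g)
  ... | x , refl = +-cancelʳ-≡ h _ _ (trans (2*non-holes+h≡N x) (trans (*-suc h (suc u′)) (+-comm h c)))

  2*holes+c≡2*m : ∀ g → 2 * holes g + c ≡ 2 * m
  2*holes+c≡2*m g = begin
    2 * holes g + c                                        ≡⟨ cong (2 * holes g +_) (sym (non-holes g)) ⟩
    2 * holes g + 2 * count (λ c → ¬? (hole c ≟ g))        ≡⟨ sym (*-distribˡ-+ 2 (holes g) _) ⟩
    2 * (holes g + count (λ c → ¬? (hole c ≟ g)))          ≡⟨ cong (2 *_) (count+count-¬≡k (λ c → hole c ≟ g)) ⟩
    2 * m                                                  ∎
    where open ≡-Reasoning

  all-equal : ∀ g → 2 * holes g ≡ 2 * holes zero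
  all-equal g = +-cancelʳ-≡ c _ _ (trans (2*holes+c≡2*m g) (sym (2*holes+c≡2*m zero)))

  H = 2 * holes zero

  2*holes₀≡h : H ≡ h
  2*holes₀≡h = *-cancelˡ-≡ H h (suc u′) (+-cancelˡ-≡ H _ _ (begin
    H + suc u′ * H                  ≡⟨⟩
    suc (suc u′) * H                ≡⟨ sym (sum-const {suc (suc u′)} H) ⟩
    sum {suc (suc u′)} (λ _ → H)     ≡⟨ sum-cong-≗ (λ g → sym (all-equal g)) ⟩
    sum (λ g → 2 * holes g)         ≡⟨ sum-*ˡ 2 holes ⟩
    2 * sum holes                   ≡⟨ cong (2 *_) sum-holes ⟩
    2 * m                           ≡⟨ sym (2*holes+c≡2*m zero) ⟩
    H + h * suc u′                  ≡⟨ cong (H +_) (*-comm h (suc u′)) ⟩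
    H + suc u′ * h                  ∎))
    where open ≡-Reasoning

-- A KTS(15) with a sub-STS(7)

module KTS15 where

  -- Points 0–11 form a group of the frame, 0–5 being its part in W; 12, 13, 14 are ∞₀, ∞₁, ∞₂.  Block 0 is
  -- the ∞-block, in class 0, and the blocks flagged by inSub form an STS(7) on 0–5 and ∞₀.
  table : Vec (Block 15) 35
  table =
    (# 12 , # 13 , # 14) ∷ (# 0 , # 2 , # 4) ∷ (# 1 , # 8 , # 11) ∷ (# 3 , # 7 , # 10) ∷ (# 5 , # 6 , # 9) ∷
    (# 12 , # 0 , # 1) ∷ (# 2 , # 13 , # 8) ∷ (# 3 , # 6 , # 11) ∷ (# 4 , # 7 , # 9) ∷ (# 5 , # 14 , # 10) ∷
    (# 12 , # 2 , # 3) ∷ (# 0 , # 13 , # 6) ∷ (# 1 , # 9 , # 10) ∷ (# 4 , # 14 , # 11) ∷ (# 5 , # 7 , # 8) ∷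
    (# 12 , # 4 , # 5) ∷ (# 0 , # 8 , # 10) ∷ (# 1 , # 14 , # 6) ∷ (# 2 , # 7 , # 11) ∷ (# 3 , # 13 , # 9) ∷
    (# 12 , # 6 , # 7) ∷ (# 0 , # 9 , # 11) ∷ (# 1 , # 2 , # 5) ∷ (# 3 , # 14 , # 8) ∷ (# 4 , # 13 , # 10) ∷
    (# 12 , # 8 , # 9) ∷ (# 0 , # 14 , # 7) ∷ (# 1 , # 3 , # 4) ∷ (# 2 , # 6 , # 10) ∷ (# 5 , # 13 , # 11) ∷
    (# 12 , # 10 , # 11) ∷ (# 0 , # 3 , # 5) ∷ (# 1 , # 13 , # 7) ∷ (# 2 , # 14 , # 9) ∷ (# 4 , # 6 , # 8) ∷ []

  block : Fin 35 → Block 15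
  block = lookup table

  class : Fin 35 → Fin 7
  class t = lookup classTable t
    where
    classTable : Vec (Fin 7) 35
    classTable =
      # 0 ∷ # 0 ∷ # 0 ∷ # 0 ∷ # 0 ∷ # 1 ∷ # 1 ∷ # 1 ∷ # 1 ∷ # 1 ∷ # 2 ∷ # 2 ∷ # 2 ∷ # 2 ∷ # 2 ∷
      # 3 ∷ # 3 ∷ # 3 ∷ # 3 ∷ # 3 ∷ # 4 ∷ # 4 ∷ # 4 ∷ # 4 ∷ # 4 ∷ # 5 ∷ # 5 ∷ # 5 ∷ # 5 ∷ # 5 ∷
      # 6 ∷ # 6 ∷ # 6 ∷ # 6 ∷ # 6 ∷ []

  sub : Subset 15
  sub = inside ∷ inside ∷ inside ∷ inside ∷ inside ∷ inside ∷
        outside ∷ outside ∷ outside ∷ outside ∷ outside ∷ outside ∷ inside ∷ outside ∷ outside ∷ []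

  inSub : Fin 35 → Bool
  inSub t = lookup subTable t
    where
    subTable : Vec Bool 35
    subTable =
      false ∷ true ∷ false ∷ false ∷ false ∷ true ∷ false ∷ false ∷ false ∷ false ∷
      true ∷ false ∷ false ∷ false ∷ false ∷ true ∷ false ∷ false ∷ false ∷ false ∷
      false ∷ false ∷ true ∷ false ∷ false ∷ false ∷ false ∷ true ∷ false ∷ false ∷
      false ∷ true ∷ false ∷ false ∷ false ∷ []

  IsTriple? : ∀ {N} (t : Block N) → Dec (IsTriple t)
  IsTriple? (a , b , c) = ¬? (a ≟ b) ×-dec ¬? (a ≟ c) ×-dec ¬? (b ≟ c)

  kts15 : KTSWithSubByCounts 15 35 7
  kts15 = record
    { block = block
    ; class = class
    ; sub = sub
    ; inSub = inSub
    ; triple = toWitness {a? = all? (IsTriple? ∘ block)} _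
    ; pairs = toWitness {a? = all? λ x → all? λ y →
        ¬? (x ≟ y) →-dec count (λ t → pair∈? x y (block t)) ℕ.≟ 1} _
    ; classes = toWitness {a? = all? λ c → all? λ x → count (λ t → (class t ≟ c) ×-dec x ∈B? block t) ℕ.≟ 1} _
    ; sub-closed = toWitness {a? = all? λ t →
        (inSub t Bool.≟ true) →-dec all? λ x → x ∈B? block t →-dec x ∈? sub} _
    ; sub-pairs = toWitness {a? = all? λ x → all? λ y → x ∈? sub →-dec y ∈? sub →-dec ¬? (x ≟ y) →-dec
        count (λ t → (inSub t Bool.≟ true) ×-dec pair∈? x y (block t)) ℕ.≟ 1} _
    }

  open KTSWithSubByCounts kts15 public using (triple; pairs; classes; sub-closed; sub-pairs)

  fin : Fin 12 → Fin 15
  fin u = u ↑ˡ 3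

  ∞ : Fin 3 → Fin 15
  ∞ j = 12 ↑ʳ j

  fin∉block₀ : ∀ u → ¬ fin u ∈B block zero
  fin∉block₀ u (inj₁ e) = ↑ˡ≢↑ʳ u zero e
  fin∉block₀ u (inj₂ (inj₁ e)) = ↑ˡ≢↑ʳ u (suc zero) e
  fin∉block₀ u (inj₂ (inj₂ e)) = ↑ˡ≢↑ʳ u (suc (suc zero)) e

  ∞∈block₀ : ∀ j → ∞ j ∈B block zero
  ∞∈block₀ zero = inj₁ refl
  ∞∈block₀ (suc zero) = inj₂ (inj₁ refl)
  ∞∈block₀ (suc (suc zero)) = inj₂ (inj₂ refl)

  private
    count-without-block₀ : {P : Fin 35 → Set} (P? : Decidable P) → ¬ P zero → count (P? ∘ suc) ≡ count P?
    count-without-block₀ P? ¬P₀ = cong (_+ count (P? ∘ suc)) (sym (𝟙-no (P? zero) ¬P₀))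

  pairs-fin : ∀ u y → fin u ≢ y → count (λ t → pair∈? (fin u) y (block (suc t))) ≡ 1
  pairs-fin u y u≢y =
    trans (count-without-block₀ (λ t → pair∈? (fin u) y (block t)) (fin∉block₀ u ∘ proj₁)) (pairs (fin u) y u≢y)

  pairs-∞ : ∀ j j′ → j ≢ j′ → count (λ t → pair∈? (∞ j) (∞ j′) (block (suc t))) ≡ 0
  pairs-∞ j j′ j≢j′ = suc-injective (trans
    (cong (_+ count (λ t → pair∈? (∞ j) (∞ j′) (block (suc t))))
      (sym (𝟙-yes (pair∈? (∞ j) (∞ j′) (block zero)) (∞∈block₀ j , ∞∈block₀ j′))))
    (pairs (∞ j) (∞ j′) (j≢j′ ∘ ↑ʳ-injective 12 j j′)))

  classes-suc : ∀ r x → count (λ t → (class (suc t) ≟ suc r) ×-dec x ∈B? block (suc t)) ≡ 1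
  classes-suc r x = classes (suc r) x

  classes-zero-fin : ∀ u → count (λ t → (class (suc t) ≟ zero) ×-dec fin u ∈B? block (suc t)) ≡ 1
  classes-zero-fin u = trans
    (count-without-block₀ (λ t → (class t ≟ zero) ×-dec fin u ∈B? block t) (fin∉block₀ u ∘ proj₂))
    (classes zero (fin u))

  classes-zero-∞ : ∀ j → count (λ t → (class (suc t) ≟ zero) ×-dec ∞ j ∈B? block (suc t)) ≡ 0
  classes-zero-∞ j = suc-injective (trans
    (cong (_+ count (λ t → (class (suc t) ≟ zero) ×-dec ∞ j ∈B? block (suc t)))
      (sym (𝟙-yes ((class zero ≟ zero) ×-dec ∞ j ∈B? block zero) (refl , ∞∈block₀ j))))
    (classes zero (∞ j)))

  fin-W∈sub : ∀ (j : Fin 6) → fin (j ↑ˡ 6) ∈ sub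
  fin-W∈sub = toWitness {a? = all? λ (j : Fin 6) → fin (j ↑ˡ 6) ∈? sub} _

  fin∈sub⁻ : ∀ u → fin u ∈ sub → ∃ λ (j : Fin 6) → u ≡ j ↑ˡ 6
  fin∈sub⁻ = toWitness {a? = all? λ u → fin u ∈? sub →-dec any? λ (j : Fin 6) → u ≟ j ↑ˡ 6} _

  ∞∈sub⁻ : ∀ j → ∞ j ∈ sub → j ≡ zero
  ∞∈sub⁻ = toWitness {a? = all? λ j → ∞ j ∈? sub →-dec j ≟ zero} _

  sub-pairs-without-block₀ : ∀ x y → x ∈ sub → y ∈ sub → x ≢ y →
    count (λ t → (inSub (suc t) Bool.≟ true) ×-dec pair∈? x y (block (suc t))) ≡ 1
  sub-pairs-without-block₀ = sub-pairs

  ∞₀∈sub : ∞ zero ∈ sub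
  ∞₀∈sub = toWitness {a? = ∞ zero ∈? sub} _

-- Filling the groups of a Kirkman frame of type (6;12)ⁿ

module Construction {n′ : ℕ} (F : KirkmanFrameGH 6 12 (suc (suc n′))) where

  n : ℕ
  n = suc (suc n′)

  N : ℕ
  N = 12 * n

  G : Fin N → Fin n
  G = proj₁ F

  B : List (Block N)
  B = proj₁ (proj₂ F)

  frame : IsKirkmanFrame 12 n G B
  frame = proj₁ (proj₂ (proj₂ F))

  W : Subset N
  W = proj₁ (proj₂ (proj₂ (proj₂ F)))

  A : Subset (length B)
  A = proj₁ (proj₂ (proj₂ (proj₂ (proj₂ F))))

  W-group-size : ∀ i → ∣ W ∩ groupSet G i ∣ ≡ 6
  W-group-size = proj₁ (proj₂ (proj₂ (proj₂ (proj₂ (proj₂ F)))))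

  A-closed : ∀ b → b ∈ A → ∀ x → x ∈B blk B b → x ∈ W
  A-closed = proj₁ (proj₂ (proj₂ (proj₂ (proj₂ (proj₂ (proj₂ F))))))

  A-pairs : ∀ x y → x ∈ W → y ∈ W → G x ≢ G y → ExactlyOne (λ b → b ∈ A × x ∈B blk B b × y ∈B blk B b)
  A-pairs = proj₂ (proj₂ (proj₂ (proj₂ (proj₂ (proj₂ (proj₂ F))))))

  open FrameCounting G B frame

  Point : Set
  Point = Fin (N + 3)

  old : Fin N → Point
  old x = x ↑ˡ 3

  ∞ : Fin 3 → Point
  ∞ j = N ↑ʳ j

  count-W : ∀ i → count (λ x → (G x ≟ i) ×-dec x ∈? W) ≡ 6
  count-W i = trans
    (sum-cong-≗ λ x → 𝟙-cong ((G x ≟ i) ×-dec x ∈? W) (x ∈? (W ∩ groupSet G i))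
      (λ (Gx≡i , x∈W) → x∈p∩q⁺ (x∈W , ∈groupSet⁺ G Gx≡i))
      (λ x∈ → let (x∈W , x∈Gi) = x∈p∩q⁻ W (groupSet G i) x∈ in ∈groupSet⁻ G x∈Gi , x∈W))
    (trans (sym (∣p∣≡count-∈ (W ∩ groupSet G i))) (W-group-size i))

  count-U : ∀ i → count (λ x → (G x ≟ i) ×-dec ¬? (x ∈? W)) ≡ 6
  count-U i = +-cancelˡ-≡ 6 _ _ (begin
    6 + count (λ x → (G x ≟ i) ×-dec ¬? (x ∈? W))
      ≡⟨ cong (_+ count (λ x → (G x ≟ i) ×-dec ¬? (x ∈? W))) (sym (count-W i)) ⟩
    count (λ x → (G x ≟ i) ×-dec x ∈? W) + count (λ x → (G x ≟ i) ×-dec ¬? (x ∈? W))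
      ≡⟨ sym (count-split (λ x → G x ≟ i) (_∈? W)) ⟩
    count (λ x → G x ≟ i)
      ≡⟨ count-group i ⟩
    12 ∎)
    where open ≡-Reasoning

  Wpart : ∀ i → Enumeration (λ x → G x ≡ i × x ∈ W) 6
  Wpart i = enumerate-≡ (λ x → (G x ≟ i) ×-dec x ∈? W) (count-W i)

  Upart : ∀ i → Enumeration (λ x → G x ≡ i × x ∉ W) 6
  Upart i = enumerate-≡ (λ x → (G x ≟ i) ×-dec ¬? (x ∈? W)) (count-U i)

  open Enumeration

  label : Fin n → Fin 12 → Fin N
  label i = [ elem (Wpart i) , elem (Upart i) ]′ ∘′ splitAt 6

  label-group : ∀ i u → G (label i u) ≡ i
  label-group i u = at (splitAt 6 u)
    where
    at : ∀ s → G ([ elem (Wpart i) , elem (Upart i) ]′ s) ≡ i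
    at (inj₁ j) = proj₁ (elem-sat (Wpart i) j)
    at (inj₂ j) = proj₁ (elem-sat (Upart i) j)

  label-injective : ∀ i → Injective _≡_ _≡_ (label i)
  label-injective i = [,]∘splitAt-injective
    (λ {j} {j′} → elem-injective (Wpart i) j j′) (λ {j} {j′} → elem-injective (Upart i) j j′)
    (λ j j′ e → proj₂ (elem-sat (Upart i) j′) (subst (_∈ W) e (proj₂ (elem-sat (Wpart i) j))))

  embed : Fin n → Fin 15 → Point
  embed i = [ old ∘′ label i , ∞ ]′ ∘′ splitAt 12

  embed-fin : ∀ i u → embed i (KTS15.fin u) ≡ old (label i u)
  embed-fin i u = cong [ old ∘′ label i , ∞ ]′ (splitAt-↑ˡ 12 u 3)

  embed-injective : ∀ i → Injective _≡_ _≡_ (embed i)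
  embed-injective i = [,]∘splitAt-injective
    (λ {u} {u′} e → label-injective i (↑ˡ-injective 3 (label i u) (label i u′) e))
    (λ {j} {j′} → ↑ʳ-injective N j j′) (λ u j → ↑ˡ≢↑ʳ (label i u) j)

  embed≢old : ∀ {i x} → G x ≢ i → ∀ k → embed i k ≢ old x
  embed≢old {i} {x} Gx≢i k = at (splitAt 12 k)
    where
    at : ∀ s → [ old ∘′ label i , ∞ ]′ s ≢ old x
    at (inj₁ u) e = Gx≢i (trans (cong G (sym (↑ˡ-injective 3 _ _ e))) (label-group i u))
    at (inj₂ j) e = ↑ˡ≢↑ʳ x j (sym e)

  record Position (x : Fin N) : Set where
    field
      pos : Fin 12
      embed-pos : embed (G x) (KTS15.fin pos) ≡ old x
      pos∈sub : x ∈ W → KTS15.fin pos ∈ KTS15.sub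

  position : ∀ x → Position x
  position x = at (x ∈? W)
    where
    at : Dec (x ∈ W) → Position x
    at (yes x∈W) = record
      { pos = j ↑ˡ 6
      ; embed-pos = trans (embed-fin (G x) (j ↑ˡ 6))
          (cong old (trans (cong [ elem (Wpart (G x)) , elem (Upart (G x)) ]′ (splitAt-↑ˡ 6 j 6))
            (elem-index (Wpart (G x)) x (refl , x∈W))))
      ; pos∈sub = λ _ → KTS15.fin-W∈sub j }
      where j = index (Wpart (G x)) x (refl , x∈W)
    at (no x∉W) = record
      { pos = 6 ↑ʳ j
      ; embed-pos = trans (embed-fin (G x) (6 ↑ʳ j))
          (cong old (trans (cong [ elem (Wpart (G x)) , elem (Upart (G x)) ]′ (splitAt-↑ʳ 6 6 j))
            (elem-index (Upart (G x)) x (refl , x∉W))))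
      ; pos∈sub = λ x∈W → ⊥-elim (x∉W x∈W) }
      where j = index (Upart (G x)) x (refl , x∉W)

  open Position

  old-injective : Injective _≡_ _≡_ old
  old-injective {x} {y} = ↑ˡ-injective 3 x y

  old≢∞ : ∀ x j → old x ≢ ∞ j
  old≢∞ = ↑ˡ≢↑ʳ

  old-as-embed : ∀ {i} x → G x ≡ i → embed i (KTS15.fin (pos (position x))) ≡ old x
  old-as-embed x refl = embed-pos (position x)

  holeClasses : ∀ i → Enumeration (λ c → hole c ≡ i) 6
  holeClasses i = enumerate-≡ (λ c → hole c ≟ i) (*-cancelˡ-≡ (holes i) 6 2 (holes-per-group {G = G} {B = B} frame i))

  Class : Set
  Class = Fin (m + 1)

  frameClass : Fin m → Class
  frameClass c = c ↑ˡ 1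

  star : Class
  star = m ↑ʳ zero

  -- Class 0 of the copy on group i joins the extra class star; class r + 1 completes the r-th partial class
  -- with hole i.
  fillClass : Fin n → Fin 7 → Class
  fillClass i zero = star
  fillClass i (suc r) = frameClass (elem (holeClasses i) r)

  rank : Fin m → Fin 6
  rank c = index (holeClasses (hole c)) c refl

  fillClass≡frameClass⇒hole : ∀ {i c} k → fillClass i k ≡ frameClass c → hole c ≡ i
  fillClass≡frameClass⇒hole zero e = ⊥-elim (↑ˡ≢↑ʳ _ zero (sym e))
  fillClass≡frameClass⇒hole {i} (suc r) e =
    subst (λ c → hole c ≡ i) (↑ˡ-injective 1 _ _ e) (elem-sat (holeClasses i) r)

  fillClass≡frameClass⇒rank : ∀ {c} k → fillClass (hole c) k ≡ frameClass c → k ≡ suc (rank c)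
  fillClass≡frameClass⇒rank zero e = ⊥-elim (↑ˡ≢↑ʳ _ zero (sym e))
  fillClass≡frameClass⇒rank {c} (suc r) e = cong suc (elem-injective (holeClasses (hole c)) r (rank c)
    (trans (↑ˡ-injective 1 _ _ e) (sym (elem-index (holeClasses (hole c)) c refl))))

  fillClass-rank : ∀ c → fillClass (hole c) (suc (rank c)) ≡ frameClass c
  fillClass-rank c = cong frameClass (elem-index (holeClasses (hole c)) c refl)

  fillClass≡star⇒zero : ∀ {i} k → fillClass i k ≡ star → k ≡ zero
  fillClass≡star⇒zero zero _ = refl
  fillClass≡star⇒zero (suc r) e = ⊥-elim (↑ˡ≢↑ʳ _ zero e)

  ∞-block : Block (N + 3)
  ∞-block = ∞ zero , ∞ (suc zero) , ∞ (suc (suc zero))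

  record Entry : Set where
    constructor entry
    field
      block : Block (N + 3)
      class : Class
      inSub : Bool

  open Entry

  frameEntry : Idx B → Entry
  frameEntry b = entry (mapBlock old (blk B b)) (frameClass (cls b)) (lookup A b)

  fillEntry : Fin n → Fin 34 → Entry
  fillEntry i t = entry (mapBlock (embed i) (KTS15.block (suc t))) (fillClass i (KTS15.class (suc t))) (KTS15.inSub (suc t))

  ∞-entry : Entry
  ∞-entry = entry ∞-block star false

  E : ℕ
  E = length B + (n * 34 + 1)

  entries : Fin E → Entry
  entries = [ frameEntry , [ uncurry fillEntry ∘′ remQuot 34 , (λ _ → ∞-entry) ]′ ∘′ splitAt (n * 34) ]′
    ∘′ splitAt (length B)

  -- Opaque, so that unification never unfolds these sums over all frame and filling blocks.
  opaque
    frame-part : (Entry → ℕ) → ℕ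
    frame-part f = sum (λ b → f (frameEntry b))

    fill-part : (Entry → ℕ) → Fin n → ℕ
    fill-part f i = sum (λ t → f (fillEntry i t))

    total : (Entry → ℕ) → ℕ
    total f = sum (λ e → f (entries e))

    frame-part-cong : ∀ f (g : Idx B → ℕ) → (∀ b → f (frameEntry b) ≡ g b) → frame-part f ≡ sum g
    frame-part-cong f g = sum-cong-≗

    fill-part-cong : ∀ f i (g : Fin 34 → ℕ) → (∀ t → f (fillEntry i t) ≡ g t) → fill-part f i ≡ sum g
    fill-part-cong f i g = sum-cong-≗

    frame-part-zero : ∀ f → (∀ b → f (frameEntry b) ≡ 0) → frame-part f ≡ 0
    frame-part-zero f = sum-zero (λ b → f (frameEntry b))

    fill-part-zero : ∀ f i → (∀ t → f (fillEntry i t) ≡ 0) → fill-part f i ≡ 0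
    fill-part-zero f i = sum-zero (λ t → f (fillEntry i t))

    total-cong : ∀ f g → (∀ e → f e ≡ g e) → total f ≡ total g
    total-cong f g f≗g = sum-cong-≗ (λ e → f≗g (entries e))

    total-sum : ∀ f → total f ≡ sum (λ e → f (entries e))
    total-sum f = refl

    sum-entries : (f : Entry → ℕ) {a b c : ℕ} →
      frame-part f ≡ a → sum (fill-part f) ≡ b → f ∞-entry ≡ c → total f ≡ a + (b + (c + 0))
    sum-entries f {a} {b} {c} frame≡a fill≡b ∞≡c = begin
      total f
        ≡⟨ sum-splitAt (length B) (λ s → f ([ frameEntry , rest ]′ s)) ⟩
      frame-part f + sum (λ r → f (rest r))
        ≡⟨ cong (frame-part f +_) (sum-splitAt (n * 34) (λ s → f ([ uncurry fillEntry ∘′ remQuot 34 , (λ _ → ∞-entry) ]′ s))) ⟩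
      frame-part f + (sum (λ q → f (uncurry fillEntry (remQuot 34 q))) + (f ∞-entry + 0))
        ≡⟨ cong (λ s → frame-part f + (s + (f ∞-entry + 0))) (sum-remQuot n 34 (λ p → f (uncurry fillEntry p))) ⟩
      frame-part f + (sum (fill-part f) + (f ∞-entry + 0))
        ≡⟨ cong₂ _+_ frame≡a (cong₂ _+_ fill≡b (cong (_+ 0) ∞≡c)) ⟩
      a + (b + (c + 0)) ∎
      where
      open ≡-Reasoning
      rest : Fin (n * 34 + 1) → Entry
      rest = [ uncurry fillEntry ∘′ remQuot 34 , (λ _ → ∞-entry) ]′ ∘′ splitAt (n * 34)

  ∞∉frameEntry : ∀ j b → ¬ ∞ j ∈B block (frameEntry b)
  ∞∉frameEntry j b = ∉B-map old (λ x → old≢∞ x j) (blk B b)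

  old∉fillEntry : ∀ {i x} → G x ≢ i → ∀ t → ¬ old x ∈B block (fillEntry i t)
  old∉fillEntry {i} Gx≢i t = ∉B-map (embed i) (embed≢old Gx≢i) (KTS15.block (suc t))

  old∉∞-block : ∀ x → ¬ old x ∈B ∞-block
  old∉∞-block x = ∉B-map ∞ (λ j e → old≢∞ x j (sym e)) (zero , suc zero , suc (suc zero))

  ∞∈∞-block : ∀ j → ∞ j ∈B ∞-block
  ∞∈∞-block zero = inj₁ refl
  ∞∈∞-block (suc zero) = inj₂ (inj₁ refl)
  ∞∈∞-block (suc (suc zero)) = inj₂ (inj₂ refl)

  data View : Point → Set where
    old-view : ∀ x → View (old x)
    ∞-view : ∀ j → View (∞ j)

  view : ∀ y → View y
  view y = at (splitAt N y) (join-splitAt N 3 y)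
    where
    at : ∀ s → join N 3 s ≡ y → View y
    at (inj₁ x) refl = old-view x
    at (inj₂ j) refl = ∞-view j

  pairs-in : Point → Point → Entry → ℕ
  pairs-in x y e = 𝟙 (pair∈? x y (block e))

  pairs-in-no : ∀ x y e → ¬ (x ∈B block e × y ∈B block e) → pairs-in x y e ≡ 0
  pairs-in-no x y e = 𝟙-no (pair∈? x y (block e))

  fill-pairs-image : ∀ i k l →
    fill-part (pairs-in (embed i k) (embed i l)) i ≡ count (λ t → pair∈? k l (KTS15.block (suc t)))
  fill-pairs-image i k l = fill-part-cong (pairs-in (embed i k) (embed i l)) i _
    (λ t → 𝟙-pair∈-map (embed i) (embed-injective i) (KTS15.block (suc t)) k l)

  fill-pairs-old : ∀ {i} a → G a ≡ i → ∀ l → KTS15.fin (pos (position a)) ≢ l →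
    fill-part (pairs-in (old a) (embed i l)) i ≡ 1
  fill-pairs-old {i} a Ga≡i l ne = subst (λ z → fill-part (pairs-in z (embed i l)) i ≡ 1) (old-as-embed a Ga≡i)
    (trans (fill-pairs-image i (KTS15.fin (pos (position a))) l) (KTS15.pairs-fin (pos (position a)) l ne))

  fill-pairs-avoidˡ : ∀ {i a} y → G a ≢ i → fill-part (pairs-in (old a) y) i ≡ 0
  fill-pairs-avoidˡ {i} {a} y Ga≢i = fill-part-zero (pairs-in (old a) y) i
    (λ t → pairs-in-no (old a) y (fillEntry i t) (old∉fillEntry Ga≢i t ∘ proj₁))

  fill-pairs-avoidʳ : ∀ {i c} x → G c ≢ i → fill-part (pairs-in x (old c)) i ≡ 0
  fill-pairs-avoidʳ {i} {c} x Gc≢i = fill-part-zero (pairs-in x (old c)) i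
    (λ t → pairs-in-no x (old c) (fillEntry i t) (old∉fillEntry Gc≢i t ∘ proj₂))

  fills-pairs-old : ∀ a y → sum (fill-part (pairs-in (old a) y)) ≡ fill-part (pairs-in (old a) y) (G a)
  fills-pairs-old a y = sum-single (fill-part (pairs-in (old a) y)) (G a) (λ i i≢Ga → fill-pairs-avoidˡ y (i≢Ga ∘ sym))

  frame-pairs-∞ : ∀ x j → frame-part (pairs-in x (∞ j)) ≡ 0
  frame-pairs-∞ x j = frame-part-zero (pairs-in x (∞ j))
    (λ b → pairs-in-no x (∞ j) (frameEntry b) (∞∉frameEntry j b ∘ proj₂))

  ∞-pairs-old : ∀ a y → pairs-in (old a) y ∞-entry ≡ 0
  ∞-pairs-old a y = pairs-in-no (old a) y ∞-entry (old∉∞-block a ∘ proj₁)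

  pair-count : Point → Point → ℕ
  pair-count x y = total (pairs-in x y)

  pair-count-sym : ∀ x y → pair-count x y ≡ pair-count y x
  pair-count-sym x y = total-cong (pairs-in x y) (pairs-in y x) (λ e → 𝟙-pair∈-sym x y (block e))

  pair-count-old-old : ∀ a c → a ≢ c → pair-count (old a) (old c) ≡ 1
  pair-count-old-old a c a≢c = by-group (G a ≟ G c)
    where
    frame-pairs : frame-part (pairs-in (old a) (old c)) ≡ count (λ b → pair∈? a c (blk B b))
    frame-pairs = frame-part-cong (pairs-in (old a) (old c)) _ (λ b → 𝟙-pair∈-map old old-injective (blk B b) a c)

    by-group : Dec (G a ≡ G c) → pair-count (old a) (old c) ≡ 1
    by-group (yes Ga≡Gc) = sum-entries (pairs-in (old a) (old c))
      (trans frame-pairs (NoneSat⇒count≡0 (λ b → pair∈? a c (blk B b))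
        (λ b (a∈ , c∈) → a≢c (Transversal-injective G (blk B b) (transversal b) a∈ c∈ Ga≡Gc))))
      (trans (fills-pairs-old a (old c))
        (subst (λ z → fill-part (pairs-in (old a) z) (G a) ≡ 1) (old-as-embed c (sym Ga≡Gc))
          (fill-pairs-old a refl (KTS15.fin (pos (position c))) positions-differ)))
      (∞-pairs-old a (old c))
      where
      positions-differ : KTS15.fin (pos (position a)) ≢ KTS15.fin (pos (position c))
      positions-differ e = a≢c (old-injective (trans (sym (old-as-embed a refl))
        (trans (cong (embed (G a)) e) (old-as-embed c (sym Ga≡Gc)))))
    by-group (no Ga≢Gc) = sum-entries (pairs-in (old a) (old c))
      (trans frame-pairs (ExactlyOne⇒count≡1 (λ b → pair∈? a c (blk B b)) (pairs a c Ga≢Gc)))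
      (sum-zero (fill-part (pairs-in (old a) (old c))) (λ i → avoid i (G a ≟ i)))
      (∞-pairs-old a (old c))
      where
      avoid : ∀ i → Dec (G a ≡ i) → fill-part (pairs-in (old a) (old c)) i ≡ 0
      avoid i (yes Ga≡i) = fill-pairs-avoidʳ (old a) (λ Gc≡i → Ga≢Gc (trans Ga≡i (sym Gc≡i)))
      avoid i (no Ga≢i) = fill-pairs-avoidˡ (old c) Ga≢i

  pair-count-old-∞ : ∀ a j → pair-count (old a) (∞ j) ≡ 1
  pair-count-old-∞ a j = sum-entries (pairs-in (old a) (∞ j))
    (frame-pairs-∞ (old a) j)
    (trans (fills-pairs-old a (∞ j)) (fill-pairs-old a refl (KTS15.∞ j) (↑ˡ≢↑ʳ (pos (position a)) j)))
    (∞-pairs-old a (∞ j))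

  pair-count-∞-∞ : ∀ j j′ → j ≢ j′ → pair-count (∞ j) (∞ j′) ≡ 1
  pair-count-∞-∞ j j′ j≢j′ = sum-entries (pairs-in (∞ j) (∞ j′))
    (frame-pairs-∞ (∞ j) j′)
    (sum-zero (fill-part (pairs-in (∞ j) (∞ j′)))
      (λ i → trans (fill-pairs-image i (KTS15.∞ j) (KTS15.∞ j′)) (KTS15.pairs-∞ j j′ j≢j′)))
    (𝟙-yes (pair∈? (∞ j) (∞ j′) ∞-block) (∞∈∞-block j , ∞∈∞-block j′))

  pair-count≡1 : ∀ x y → x ≢ y → pair-count x y ≡ 1
  pair-count≡1 x y x≢y = at (view x) (view y) x≢y
    where
    at : ∀ {x y} → View x → View y → x ≢ y → pair-count x y ≡ 1
    at (old-view a) (old-view c) ne = pair-count-old-old a c (ne ∘ cong old)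
    at (old-view a) (∞-view j) _ = pair-count-old-∞ a j
    at (∞-view j) (old-view c) _ = trans (pair-count-sym (∞ j) (old c)) (pair-count-old-∞ c j)
    at (∞-view j) (∞-view j′) ne = pair-count-∞-∞ j j′ (ne ∘ cong ∞)

  classes-in : Class → Point → Entry → ℕ
  classes-in C y e = 𝟙 ((class e ≟ C) ×-dec y ∈B? block e)

  classes-in-no : ∀ C y e → ¬ (class e ≡ C × y ∈B block e) → classes-in C y e ≡ 0
  classes-in-no C y e = 𝟙-no ((class e ≟ C) ×-dec y ∈B? block e)

  fill-classes-image : ∀ i C k r → fillClass i r ≡ C → (∀ k′ → fillClass i k′ ≡ C → k′ ≡ r) →
    fill-part (classes-in C (embed i k)) i ≡ count (λ t → (KTS15.class (suc t) ≟ r) ×-dec k ∈B? KTS15.block (suc t))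
  fill-classes-image i C k r r↦C C⇒r = fill-part-cong (classes-in C (embed i k)) i _ λ t → 𝟙-cong
    ((fillClass i (KTS15.class (suc t)) ≟ C) ×-dec embed i k ∈B? mapBlock (embed i) (KTS15.block (suc t)))
    ((KTS15.class (suc t) ≟ r) ×-dec k ∈B? KTS15.block (suc t))
    (λ (e , k∈) → C⇒r _ e , ∈B-map-injective (embed i) (embed-injective i) (KTS15.block (suc t)) k∈)
    (λ (e , k∈) → trans (cong (fillClass i) e) r↦C , ∈B-map (embed i) (KTS15.block (suc t)) k∈)

  fill-classes-hole : ∀ c k → fill-part (classes-in (frameClass c) (embed (hole c) k)) (hole c) ≡ 1
  fill-classes-hole c k = trans
    (fill-classes-image (hole c) (frameClass c) k (suc (rank c)) (fillClass-rank c)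
      (λ k′ → fillClass≡frameClass⇒rank {c} k′))
    (KTS15.classes-suc (rank c) k)

  fills-classes-hole : ∀ c y →
    sum (fill-part (classes-in (frameClass c) y)) ≡ fill-part (classes-in (frameClass c) y) (hole c)
  fills-classes-hole c y = sum-single (fill-part (classes-in (frameClass c) y)) (hole c) λ i i≢hc →
    fill-part-zero (classes-in (frameClass c) y) i λ t → classes-in-no (frameClass c) y (fillEntry i t)
      (λ (e , _) → i≢hc (sym (fillClass≡frameClass⇒hole {i} {c} (KTS15.class (suc t)) e)))

  fill-classes-avoid : ∀ {i x} C → G x ≢ i → fill-part (classes-in C (old x)) i ≡ 0
  fill-classes-avoid {i} {x} C Gx≢i = fill-part-zero (classes-in C (old x)) i
    (λ t → classes-in-no C (old x) (fillEntry i t) (old∉fillEntry Gx≢i t ∘ proj₂))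

  frame-classes-∞ : ∀ C j → frame-part (classes-in C (∞ j)) ≡ 0
  frame-classes-∞ C j = frame-part-zero (classes-in C (∞ j))
    (λ b → classes-in-no C (∞ j) (frameEntry b) (∞∉frameEntry j b ∘ proj₂))

  frame-classes-star : ∀ y → frame-part (classes-in star y) ≡ 0
  frame-classes-star y = frame-part-zero (classes-in star y)
    (λ b → classes-in-no star y (frameEntry b) (↑ˡ≢↑ʳ (cls b) zero ∘ proj₁))

  ∞-classes-frame : ∀ c y → classes-in (frameClass c) y ∞-entry ≡ 0
  ∞-classes-frame c y = classes-in-no (frameClass c) y ∞-entry (↑ˡ≢↑ʳ c zero ∘ sym ∘ proj₁)

  ∞-classes-old : ∀ C x → classes-in C (old x) ∞-entry ≡ 0
  ∞-classes-old C x = classes-in-no C (old x) ∞-entry (old∉∞-block x ∘ proj₂)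

  class-count : Class → Point → ℕ
  class-count C y = total (classes-in C y)

  class-count-frame-old : ∀ c x → class-count (frameClass c) (old x) ≡ 1
  class-count-frame-old c x = by-hole (G x ≟ hole c)
    where
    frame-classes : frame-part (classes-in (frameClass c) (old x)) ≡ count (λ b → (cls b ≟ c) ×-dec x ∈B? blk B b)
    frame-classes = frame-part-cong (classes-in (frameClass c) (old x)) _ λ b → 𝟙-cong
      ((frameClass (cls b) ≟ frameClass c) ×-dec old x ∈B? mapBlock old (blk B b))
      ((cls b ≟ c) ×-dec x ∈B? blk B b)
      (λ (e , x∈) → ↑ˡ-injective 1 (cls b) c e , ∈B-map-injective old old-injective (blk B b) x∈)
      (λ (e , x∈) → cong frameClass e , ∈B-map old (blk B b) x∈)

    by-hole : Dec (G x ≡ hole c) → class-count (frameClass c) (old x) ≡ 1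
    by-hole (yes Gx≡hc) = sum-entries (classes-in (frameClass c) (old x))
      (trans frame-classes (NoneSat⇒count≡0 (λ b → (cls b ≟ c) ×-dec x ∈B? blk B b) (proj₁ (resolution c x) Gx≡hc)))
      (trans (fills-classes-hole c (old x))
        (subst (λ z → fill-part (classes-in (frameClass c) z) (hole c) ≡ 1) (old-as-embed x Gx≡hc)
          (fill-classes-hole c (KTS15.fin (pos (position x))))))
      (∞-classes-frame c (old x))
    by-hole (no Gx≢hc) = sum-entries (classes-in (frameClass c) (old x))
      (trans frame-classes (ExactlyOne⇒count≡1 (λ b → (cls b ≟ c) ×-dec x ∈B? blk B b) (proj₂ (resolution c x) Gx≢hc)))
      (trans (fills-classes-hole c (old x)) (fill-classes-avoid (frameClass c) Gx≢hc))
      (∞-classes-frame c (old x))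

  class-count-frame-∞ : ∀ c j → class-count (frameClass c) (∞ j) ≡ 1
  class-count-frame-∞ c j = sum-entries (classes-in (frameClass c) (∞ j))
    (frame-classes-∞ (frameClass c) j)
    (trans (fills-classes-hole c (∞ j)) (fill-classes-hole c (KTS15.∞ j)))
    (∞-classes-frame c (∞ j))

  class-count-star-old : ∀ x → class-count star (old x) ≡ 1
  class-count-star-old x = sum-entries (classes-in star (old x))
    (frame-classes-star (old x))
    (trans (sum-single (fill-part (classes-in star (old x))) (G x) (λ i i≢Gx → fill-classes-avoid star (i≢Gx ∘ sym)))
      (subst (λ z → fill-part (classes-in star z) (G x) ≡ 1) (old-as-embed x refl)
        (trans (fill-classes-image (G x) star (KTS15.fin (pos (position x))) zero refl (λ k′ → fillClass≡star⇒zero {G x} k′))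
          (KTS15.classes-zero-fin (pos (position x))))))
    (∞-classes-old star x)

  class-count-star-∞ : ∀ j → class-count star (∞ j) ≡ 1
  class-count-star-∞ j = sum-entries (classes-in star (∞ j))
    (frame-classes-star (∞ j))
    (sum-zero (fill-part (classes-in star (∞ j))) λ i →
      trans (fill-classes-image i star (KTS15.∞ j) zero refl (λ k′ → fillClass≡star⇒zero {i} k′)) (KTS15.classes-zero-∞ j))
    (𝟙-yes ((star ≟ star) ×-dec ∞ j ∈B? ∞-block) (refl , ∞∈∞-block j))

  class-count≡1 : ∀ C y → class-count C y ≡ 1
  class-count≡1 C y = at (splitAt m C) (join-splitAt m 1 C) (view y)
    where
    at : ∀ {C y} s → join m 1 s ≡ C → View y → class-count C y ≡ 1
    at (inj₁ c) refl (old-view x) = class-count-frame-old c x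
    at (inj₁ c) refl (∞-view j) = class-count-frame-∞ c j
    at (inj₂ zero) refl (old-view x) = class-count-star-old x
    at (inj₂ zero) refl (∞-view j) = class-count-star-∞ j

  S : Subset (N + 3)
  S = W ++ ⁅ zero ⁆

  old∈S : ∀ {x} → x ∈ W → old x ∈ S
  old∈S {x} x∈W = lookup⇒[]= (old x) S (trans (lookup-++ˡ W ⁅ zero ⁆ x) ([]=⇒lookup x∈W))

  old∈S⁻ : ∀ {x} → old x ∈ S → x ∈ W
  old∈S⁻ {x} x∈S = lookup⇒[]= x W (trans (sym (lookup-++ˡ W ⁅ zero ⁆ x)) ([]=⇒lookup x∈S))

  ∞∈S⁻ : ∀ {j} → ∞ j ∈ S → j ≡ zero
  ∞∈S⁻ {j} ∞∈S =
    x∈⁅y⁆⇒x≡y zero (lookup⇒[]= j ⁅ zero ⁆ (trans (sym (lookup-++ʳ W ⁅ zero ⁆ j)) ([]=⇒lookup ∞∈S)))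

  ∞₀∈S : ∞ zero ∈ S
  ∞₀∈S = lookup⇒[]= (∞ zero) S (lookup-++ʳ W ⁅ zero ⁆ zero)

  ∣W∣≡6n : ∣ W ∣ ≡ 6 * n
  ∣W∣≡6n = begin
    ∣ W ∣                                                   ≡⟨ ∣p∣≡count-∈ W ⟩
    count (_∈? W)                                           ≡⟨ sum-cong-≗ (λ x → sym (count-on-diagonal (G x) (x ∈? W))) ⟩
    sum (λ x → count (λ i → (G x ≟ i) ×-dec x ∈? W))        ≡⟨ ∑-comm (λ x i → 𝟙 ((G x ≟ i) ×-dec x ∈? W)) ⟩
    sum (λ i → count (λ x → (G x ≟ i) ×-dec x ∈? W))        ≡⟨ sum-cong-≗ count-W ⟩
    sum {n} (λ _ → 6)                                       ≡⟨ sum-const {n} 6 ⟩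
    n * 6                                                   ≡⟨ *-comm n 6 ⟩
    6 * n                                                   ∎
    where open ≡-Reasoning

  ∣S∣≡6n+1 : ∣ S ∣ ≡ 6 * n + 1
  ∣S∣≡6n+1 = trans (∣p++q∣ W ⁅ zero ⁆) (cong (_+ 1) ∣W∣≡6n)
    where
    ∣p++q∣ : ∀ {a b} (p : Subset a) (q : Subset b) → ∣ p ++ q ∣ ≡ ∣ p ∣ + ∣ q ∣
    ∣p++q∣ [] q = refl
    ∣p++q∣ (inside ∷ p) q = cong suc (∣p++q∣ p q)
    ∣p++q∣ (outside ∷ p) q = ∣p++q∣ p q

  embed-sub : ∀ i k → k ∈ KTS15.sub → embed i k ∈ S
  embed-sub i k = at (splitAt 12 k) (join-splitAt 12 3 k)
    where
    at : ∀ s → join 12 3 s ≡ k → k ∈ KTS15.sub → embed i k ∈ S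
    at (inj₁ u) refl u∈sub with KTS15.fin∈sub⁻ u u∈sub
    ... | j , refl = subst (_∈ S) (sym (trans (embed-fin i (j ↑ˡ 6))
          (cong (old ∘′ [ elem (Wpart i) , elem (Upart i) ]′) (splitAt-↑ˡ 6 j 6))))
        (old∈S (proj₂ (elem-sat (Wpart i) j)))
    at (inj₂ j) refl ∞∈sub = subst (λ j → ∞ j ∈ S) (sym (KTS15.∞∈sub⁻ j ∞∈sub)) ∞₀∈S

  entries-ind : (Q : Entry → Set) → (∀ b → Q (frameEntry b)) → (∀ i t → Q (fillEntry i t)) → Q ∞-entry →
    ∀ e → Q (entries e)
  entries-ind Q frame-case fill-case ∞-case e = at (splitAt (length B) e)
    where
    at : ∀ s → Q ([ frameEntry , [ uncurry fillEntry ∘′ remQuot 34 , (λ _ → ∞-entry) ]′ ∘′ splitAt (n * 34) ]′ s)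
    at (inj₁ b) = frame-case b
    at (inj₂ r) = at′ (splitAt (n * 34) r)
      where
      at′ : ∀ s → Q ([ uncurry fillEntry ∘′ remQuot 34 , (λ _ → ∞-entry) ]′ s)
      at′ (inj₁ q) = fill-case (proj₁ (remQuot {n} 34 q)) (proj₂ (remQuot {n} 34 q))
      at′ (inj₂ _) = ∞-case

  entries-triple : ∀ e → IsTriple (block (entries e))
  entries-triple = entries-ind (IsTriple ∘′ block)
    (λ b → IsTriple-map old old-injective (blk B b) (Transversal⇒IsTriple G (blk B b) (transversal b)))
    (λ i t → IsTriple-map (embed i) (embed-injective i) (KTS15.block (suc t)) (KTS15.triple (suc t)))
    (IsTriple-map ∞ (λ {j} {j′} → ↑ʳ-injective N j j′) (zero , suc zero , suc (suc zero))
      ((λ ()) , (λ ()) , (λ ())))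

  entries-sub-closed : ∀ e → inSub (entries e) ≡ true → ∀ y → y ∈B block (entries e) → y ∈ S
  entries-sub-closed = entries-ind (λ e → inSub e ≡ true → ∀ y → y ∈B block e → y ∈ S)
    (λ b b∈A y y∈ → let (x , y≡old , x∈) = ∈B-map⁻ old (blk B b) y∈ in
      subst (_∈ S) (sym y≡old) (old∈S (A-closed b (lookup⇒[]= b A b∈A) x x∈)))
    (λ i t inSub y y∈ → let (k , y≡ , k∈) = ∈B-map⁻ (embed i) (KTS15.block (suc t)) y∈ in
      subst (_∈ S) (sym y≡) (embed-sub i k (KTS15.sub-closed (suc t) inSub k k∈)))
    (λ ())

  subpairs-in : Point → Point → Entry → ℕ
  subpairs-in x y e = 𝟙 ((inSub e Bool.≟ true) ×-dec pair∈? x y (block e))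

  subpairs-in-no : ∀ x y e → ¬ (inSub e ≡ true × x ∈B block e × y ∈B block e) → subpairs-in x y e ≡ 0
  subpairs-in-no x y e = 𝟙-no ((inSub e Bool.≟ true) ×-dec pair∈? x y (block e))

  fill-subpairs-image : ∀ i k l → fill-part (subpairs-in (embed i k) (embed i l)) i ≡
    count (λ t → (KTS15.inSub (suc t) Bool.≟ true) ×-dec pair∈? k l (KTS15.block (suc t)))
  fill-subpairs-image i k l = fill-part-cong (subpairs-in (embed i k) (embed i l)) i _ λ t → 𝟙-cong
    ((KTS15.inSub (suc t) Bool.≟ true) ×-dec pair∈? (embed i k) (embed i l) (mapBlock (embed i) (KTS15.block (suc t))))
    ((KTS15.inSub (suc t) Bool.≟ true) ×-dec pair∈? k l (KTS15.block (suc t)))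
    (λ (s , k∈ , l∈) →
      s , ∈B-map-injective (embed i) (embed-injective i) _ k∈ , ∈B-map-injective (embed i) (embed-injective i) _ l∈)
    (λ (s , k∈ , l∈) → s , ∈B-map (embed i) _ k∈ , ∈B-map (embed i) _ l∈)

  fill-subpairs-old : ∀ {i} a → G a ≡ i → a ∈ W → ∀ l → l ∈ KTS15.sub → KTS15.fin (pos (position a)) ≢ l →
    fill-part (subpairs-in (old a) (embed i l)) i ≡ 1
  fill-subpairs-old {i} a Ga≡i a∈W l l∈ ne =
    subst (λ z → fill-part (subpairs-in z (embed i l)) i ≡ 1) (old-as-embed a Ga≡i)
    (trans (fill-subpairs-image i (KTS15.fin (pos (position a))) l)
      (KTS15.sub-pairs-without-block₀ (KTS15.fin (pos (position a))) l (pos∈sub (position a) a∈W) l∈ ne))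

  fill-subpairs-avoid : ∀ {i a} y → G a ≢ i → fill-part (subpairs-in (old a) y) i ≡ 0
  fill-subpairs-avoid {i} {a} y Ga≢i = fill-part-zero (subpairs-in (old a) y) i
    (λ t → subpairs-in-no (old a) y (fillEntry i t) (λ (_ , a∈ , _) → old∉fillEntry Ga≢i t a∈))

  fills-subpairs-old : ∀ a y → sum (fill-part (subpairs-in (old a) y)) ≡ fill-part (subpairs-in (old a) y) (G a)
  fills-subpairs-old a y =
    sum-single (fill-part (subpairs-in (old a) y)) (G a) (λ i i≢Ga → fill-subpairs-avoid y (i≢Ga ∘ sym))

  subpair-count : Point → Point → ℕ
  subpair-count x y = total (subpairs-in x y)

  subpair-count-sym : ∀ x y → subpair-count x y ≡ subpair-count y x
  subpair-count-sym x y = total-cong (subpairs-in x y) (subpairs-in y x) λ e → 𝟙-cong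
    ((inSub e Bool.≟ true) ×-dec pair∈? x y (block e)) ((inSub e Bool.≟ true) ×-dec pair∈? y x (block e))
    (λ (s , p , q) → s , q , p) (λ (s , p , q) → s , q , p)

  subpair-count-old-old : ∀ a c → a ∈ W → c ∈ W → a ≢ c → subpair-count (old a) (old c) ≡ 1
  subpair-count-old-old a c a∈W c∈W a≢c = by-group (G a ≟ G c)
    where
    frame-subpairs : frame-part (subpairs-in (old a) (old c)) ≡ count (λ b → b ∈? A ×-dec pair∈? a c (blk B b))
    frame-subpairs = frame-part-cong (subpairs-in (old a) (old c)) _ λ b → 𝟙-cong
      ((lookup A b Bool.≟ true) ×-dec pair∈? (old a) (old c) (mapBlock old (blk B b)))
      (b ∈? A ×-dec pair∈? a c (blk B b))
      (λ (s , a∈ , c∈) →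
        lookup⇒[]= b A s , ∈B-map-injective old old-injective _ a∈ , ∈B-map-injective old old-injective _ c∈)
      (λ (b∈A , a∈ , c∈) → []=⇒lookup b∈A , ∈B-map old _ a∈ , ∈B-map old _ c∈)

    by-group : Dec (G a ≡ G c) → subpair-count (old a) (old c) ≡ 1
    by-group (yes Ga≡Gc) = sum-entries (subpairs-in (old a) (old c))
      (trans frame-subpairs (NoneSat⇒count≡0 (λ b → b ∈? A ×-dec pair∈? a c (blk B b))
        (λ b (_ , a∈ , c∈) → a≢c (Transversal-injective G (blk B b) (transversal b) a∈ c∈ Ga≡Gc))))
      (trans (fills-subpairs-old a (old c))
        (subst (λ z → fill-part (subpairs-in (old a) z) (G a) ≡ 1) (old-as-embed c (sym Ga≡Gc))
          (fill-subpairs-old a refl a∈W (KTS15.fin (pos (position c))) (pos∈sub (position c) c∈W) positions-differ)))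
      refl
      where
      positions-differ : KTS15.fin (pos (position a)) ≢ KTS15.fin (pos (position c))
      positions-differ e = a≢c (old-injective (trans (sym (old-as-embed a refl))
        (trans (cong (embed (G a)) e) (old-as-embed c (sym Ga≡Gc)))))
    by-group (no Ga≢Gc) = sum-entries (subpairs-in (old a) (old c))
      (trans frame-subpairs (ExactlyOne⇒count≡1 (λ b → b ∈? A ×-dec pair∈? a c (blk B b)) (A-pairs a c a∈W c∈W Ga≢Gc)))
      (trans (fills-subpairs-old a (old c)) (fill-part-zero (subpairs-in (old a) (old c)) (G a)
        (λ t → subpairs-in-no (old a) (old c) (fillEntry (G a) t) (λ (_ , _ , c∈) → old∉fillEntry (Ga≢Gc ∘ sym) t c∈))))
      refl

  subpair-count-old-∞₀ : ∀ a → a ∈ W → subpair-count (old a) (∞ zero) ≡ 1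
  subpair-count-old-∞₀ a a∈W = sum-entries (subpairs-in (old a) (∞ zero))
    (frame-part-zero (subpairs-in (old a) (∞ zero))
      (λ b → subpairs-in-no (old a) (∞ zero) (frameEntry b) (λ (_ , _ , ∞∈) → ∞∉frameEntry zero b ∞∈)))
    (trans (fills-subpairs-old a (∞ zero))
      (fill-subpairs-old a refl a∈W (KTS15.∞ zero) KTS15.∞₀∈sub (↑ˡ≢↑ʳ (pos (position a)) zero)))
    refl

  subpair-count≡1 : ∀ x y → x ∈ S → y ∈ S → x ≢ y → subpair-count x y ≡ 1
  subpair-count≡1 x y = at (view x) (view y)
    where
    at : ∀ {x y} → View x → View y → x ∈ S → y ∈ S → x ≢ y → subpair-count x y ≡ 1
    at (old-view a) (old-view c) a∈ c∈ ne = subpair-count-old-old a c (old∈S⁻ a∈) (old∈S⁻ c∈) (ne ∘ cong old)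
    at (old-view a) (∞-view j) a∈ ∞∈ _ with ∞∈S⁻ ∞∈
    ... | refl = subpair-count-old-∞₀ a (old∈S⁻ a∈)
    at (∞-view j) (old-view c) ∞∈ c∈ _ with ∞∈S⁻ ∞∈
    ... | refl = trans (subpair-count-sym (∞ zero) (old c)) (subpair-count-old-∞₀ c (old∈S⁻ c∈))
    at (∞-view j) (∞-view j′) ∞∈ ∞∈′ ne = ⊥-elim (ne (cong ∞ (trans (∞∈S⁻ ∞∈) (sym (∞∈S⁻ ∞∈′)))))

  design : KTSWithSubByCounts (N + 3) E (m + 1)
  design = record
    { block = block ∘′ entries
    ; class = class ∘′ entries
    ; sub = S
    ; inSub = inSub ∘′ entries
    ; triple = entries-triple
    ; pairs = λ x y x≢y → trans (sym (total-sum (pairs-in x y))) (pair-count≡1 x y x≢y)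
    ; classes = λ C y → trans (sym (total-sum (classes-in C y))) (class-count≡1 C y)
    ; sub-closed = entries-sub-closed
    ; sub-pairs = λ x y x∈ y∈ x≢y → trans (sym (total-sum (subpairs-in x y))) (subpair-count≡1 x y x∈ y∈ x≢y)
    }

lemma4p3 : (n : ℕ) → 1 ≤ n → KirkmanFrameGH 6 12 n →
    Σ (List (Block (12 * n + 3))) λ B →
      IsKTS (12 * n + 3) B × HasSubSTS B (6 * n + 1)
lemma4p3 (suc zero) _ _ = blocks , isKTS , hasSubSTS
  where open KTSWithSubByCounts KTS15.kts15
lemma4p3 (suc (suc n′)) _ F = blocks , isKTS , subst (HasSubSTS blocks) ∣S∣≡6n+1 hasSubSTS
  where
  open Construction F using (design; ∣S∣≡6n+1)
  open KTSWithSubByCounts design
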